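{- Let $q$ be a prime power, $m,n$ positive integers, and let $\alpha\in\mathbb{F}_{q^{mn}}$ be such that $\mathbb{F}_{q^{mn}}=\mathbb{F}_q(\alpha)$. Let $\mathfrak{S}_\alpha$ be the set of $m$-dimensional $\alpha$-splitting subspaces of $\mathbb{F}_{q^{mn}}$ and, for $x\in\mathbb{F}_{q^{mn}}$, let $\mathfrak{S}_\alpha^x=\{W\in\mathfrak{S}_\alpha : x\in W\}$. Then $|\mathfrak{S}_\alpha^x|=|\mathfrak{S}_\alpha^y|$ for all $x,y\in\mathbb{F}_{q^{mn}}^*$. Moreover, for every $x\in\mathbb{F}_{q^{mn}}^*$ the set $\mathfrak{S}_\alpha^x$ is nonempty and $$S(\alpha,m,n;q)=|\mathfrak{S}_\alpha^x|\,\frac{q^{mn}-1}{q^m-1},$$ where $S(\alpha,m,n;q)=|\mathfrak{S}_\alpha|$.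
   Context: $\mathbb{F}_q$ denotes the finite field with $q$ elements and $\mathbb{F}_{q^{mn}}^*$ the set of nonzero elements of $\mathbb{F}_{q^{mn}}$. An $m$-dimensional $\mathbb{F}_q$-linear subspace $W$ of $\mathbb{F}_{q^{mn}}$ is called $\alpha$-splitting if $\mathbb{F}_{q^{mn}}=W\oplus \alpha W\oplus\cdots\oplus\alpha^{n-1}W$ (internal direct sum of $\mathbb{F}_q$-subspaces). -}

module Defs where

open import Level using (_⊔_)
open import Data.Nat using (ℕ; zero; suc; _≤_)
import Data.Nat as ℕ
open import Data.Nat.Primality using (Prime)
open import Data.Fin using (Fin; toℕ)
open import Data.Fin.Subset using (Subset) renaming (_∈_ to _∈ₛ_)
open import Data.Vec using (Vec; []; _∷_; lookup; zipWith; foldr; tabulate)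
open import Data.List using (List; length)
open import Data.List.Membership.Propositional using () renaming (_∈_ to _∈ₗ_)
open import Data.List.Relation.Unary.Unique.Propositional using (Unique)
open import Data.Product using (Σ; ∃; ∃-syntax; _×_)
open import Function.Bundles using (_⇔_)
open import Relation.Nullary using (¬_)
open import Relation.Binary.PropositionalEquality using (_≡_)
open import Algebra.Bundles using (CommutativeRing)

IsPrimePower : ℕ → Set
IsPrimePower q = ∃[ p ] ∃[ k ] (Prime p × 1 ≤ k × q ≡ p ℕ.^ k)

HasCount : ∀ {a p} {A : Set a} → (A → Set p) → ℕ → Set (a ⊔ p)
HasCount {A = A} P k =
  Σ (List A) λ xs → Unique xs × length xs ≡ k × (∀ x → (x ∈ₗ xs) ⇔ P x)

-- Standing data: a commutative ring R (to be a field), whose carrier is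
-- enumerated bijectively (up to ≈) by e : Fin N → Carrier.
-- Subsets of the field are represented as subsets of the index set Fin N.
module FieldTheory {c ℓ} (R : CommutativeRing c ℓ) {N : ℕ}
                   (e : Fin N → CommutativeRing.Carrier R) where
  open CommutativeRing R

  IsField : Set (c ⊔ ℓ)
  IsField = (¬ (1# ≈ 0#)) × (∀ x → ¬ (x ≈ 0#) → ∃[ y ] (x * y ≈ 1#))

  IsEnumeration : Set (c ⊔ ℓ)
  IsEnumeration = (∀ i j → e i ≈ e j → i ≡ j) × (∀ x → ∃[ i ] (e i ≈ x))

  _∈_ : Carrier → Subset N → Set ℓ
  x ∈ S = ∃[ i ] (i ∈ₛ S × e i ≈ x)

  _^′_ : Carrier → ℕ → Carrier
  x ^′ zero = 1#
  x ^′ suc k = x * (x ^′ k)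

  ∑ : ∀ {k} → Vec Carrier k → Carrier
  ∑ = foldr _ _+_ 0#

  IsSubfield : Subset N → Set (c ⊔ ℓ)
  IsSubfield F = (0# ∈ F) × (1# ∈ F)
    × (∀ x y → x ∈ F → y ∈ F → (x + y) ∈ F)
    × (∀ x → x ∈ F → (- x) ∈ F)
    × (∀ x y → x ∈ F → y ∈ F → (x * y) ∈ F)
    × (∀ x y → x ∈ F → ¬ (x ≈ 0#) → x * y ≈ 1# → y ∈ F)

  IsSubfieldP : ∀ {p} → (Carrier → Set p) → Set (c ⊔ ℓ ⊔ p)
  IsSubfieldP L = L 0# × L 1#
    × (∀ x y → L x → L y → L (x + y))
    × (∀ x → L x → L (- x))
    × (∀ x y → L x → L y → L (x * y))
    × (∀ x y → L x → ¬ (x ≈ 0#) → x * y ≈ 1# → L y)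
    × (∀ x y → x ≈ y → L x → L y)

  -- F(α) is the whole field: every subfield containing F and α is everything
  GeneratesOver : Subset N → Carrier → Set (Level.suc (c ⊔ ℓ))
  GeneratesOver F α = ∀ (L : Carrier → Set (c ⊔ ℓ)) → IsSubfieldP L
    → (∀ x → x ∈ F → L x) → L α → ∀ x → L x

  IsSubspace : Subset N → Subset N → Set (c ⊔ ℓ)
  IsSubspace F W = (0# ∈ W)
    × (∀ x y → x ∈ W → y ∈ W → (x + y) ∈ W)
    × (∀ a x → a ∈ F → x ∈ W → (a * x) ∈ W)

  lincomb : ∀ {k} → Vec Carrier k → Vec Carrier k → Carrier
  lincomb cs vs = ∑ (zipWith _*_ cs vs)

  HasDim : Subset N → Subset N → ℕ → Set (c ⊔ ℓ)
  HasDim F W m = ∃[ v ] (∀ (i : Fin m) → lookup v i ∈ W)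
    × (∀ w → w ∈ W → ∃[ cs ] ((∀ (i : Fin m) → lookup cs i ∈ F)
                              × lincomb cs v ≈ w))
    × (∀ cs → (∀ (i : Fin m) → lookup cs i ∈ F) → lincomb cs v ≈ 0#
            → ∀ (i : Fin m) → lookup cs i ≈ 0#)

  αsum : Carrier → ∀ {n} → Vec Carrier n → Carrier
  αsum α {n} w = ∑ (tabulate λ (i : Fin n) → (α ^′ toℕ i) * lookup w i)

  -- the field is the internal direct sum W ⊕ αW ⊕ ⋯ ⊕ α^{n-1}W
  IsSplitting : Carrier → ℕ → Subset N → Set (c ⊔ ℓ)
  IsSplitting α n W =
    (∀ z → ∃[ w ] ((∀ (i : Fin n) → lookup w i ∈ W) × αsum α w ≈ z))
    × (∀ w w′ → (∀ (i : Fin n) → lookup w i ∈ W)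
              → (∀ (i : Fin n) → lookup w′ i ∈ W)
              → αsum α w ≈ αsum α w′ → ∀ (i : Fin n) → lookup w i ≈ lookup w′ i)

  𝔖 : Subset N → Carrier → ℕ → ℕ → Subset N → Set (c ⊔ ℓ)
  𝔖 F α m n W = IsSubspace F W × HasDim F W m × IsSplitting α n W

  𝔖at : Subset N → Carrier → ℕ → ℕ → Carrier → Subset N → Set (c ⊔ ℓ)
  𝔖at F α m n x W = 𝔖 F α m n W × x ∈ W

module Submission where

-- Multiplication by u ≠ 0 permutes 𝔖_α and maps 𝔖_α^x onto 𝔖_α^(ux), so all 𝔖_α^x with x ≠ 0 have
-- the same size t.  Each W ∈ 𝔖_α has q^m elements, 0 among them; counting the pairs x ∈ W in two
-- ways gives S·q^m = S + (q^(mn) − 1)·t.  Finally t ≥ 1: as 1, α, …, α^(mn−1) span the field,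
-- W₀ = ⟨1, αⁿ, …, α^((m−1)n)⟩ satisfies W₀ + αW₀ + ⋯ + α^(n−1)W₀ = 𝔽_{q^(mn)}, so |W₀|^n ≥ q^(mn)
-- while |W₀| ≤ q^m; hence both the coordinate map F^m → W₀ and the sum map W₀^n → 𝔽_{q^(mn)} are
-- bijective, and W₀ ∈ 𝔖_α^1.  The field is finite and enumerated, so all these predicates are
-- decidable and the sets are counted as filtered lists of subsets.

module Counting where
  open import Level using (Level)
  open import Data.Bool using (true; false; if_then_else_)
  open import Data.Nat as ℕ using (ℕ; zero; suc; _+_; _*_; _∸_; _^_; _≤_; _<_; z≤n; s≤s)
  import Data.Nat.Properties as ℕ
  open import Data.Fin using (Fin; zero; suc; punchIn)
  open import Data.Fin.Properties using (punchInᵢ≢i) renaming (suc-injective to Fin-suc-injective)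
  open import Data.Fin.Subset using (Subset; ∣_∣; inside; outside) renaming (_∈_ to _∈ₛ_)
  open import Data.Fin.Subset.Properties using () renaming (_∈?_ to _∈ₛ?_)
  open import Data.List using (List; []; _∷_; _++_; length; map; filter; cartesianProductWith)
  open import Data.List.Properties using (length-map; length-++; filter-notAll)
  open import Data.List.Membership.Propositional using (_∈_; _∉_)
  open import Data.List.Membership.Propositional.Properties
    using (∈-map⁺; ∈-map⁻; ∈-filter⁺; ∈-cartesianProductWith⁺; ∈-cartesianProductWith⁻)
  import Data.List.Membership.DecPropositional as DecMembership
  open import Data.List.Relation.Binary.Subset.Propositional using (_⊆_)
  open import Data.List.Relation.Unary.Any as Any using (here; there)
  open import Data.List.Relation.Unary.All as All using (All; []; _∷_)
  import Data.List.Relation.Unary.All.Properties as AllP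
  open import Data.List.Relation.Unary.AllPairs using ([]; _∷_)
  open import Data.List.Relation.Unary.Unique.Propositional using (Unique)
  import Data.List.Relation.Unary.Unique.Propositional.Properties as Unique
  open import Data.Vec using (Vec; []; _∷_; here; there; lookup; tabulate)
  open import Data.Vec.Properties using (∷-injective; lookup∘tabulate; []=⇒lookup; lookup⇒[]=)
  open import Data.Product using (_,_)
  open import Function using (_∘_)
  open import Function.Bundles using (_⇔_; mk⇔)
  open import Relation.Nullary using (Dec; yes; no; does; ¬?; contradiction)
  open import Relation.Nullary.Decidable using (dec-true)
  open import Relation.Binary.Definitions using (DecidableEquality)
  open import Relation.Binary.PropositionalEquality
    using (_≡_; _≢_; refl; sym; trans; cong; cong₂; subst; module ≡-Reasoning)
  open import Algebra.Properties.CommutativeMonoid.Sum ℕ.+-0-commutativeMonoid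
    using (∑-distrib-+; sum-remove; sum-cong-≗; sum-syntax)

  private
    variable
      a b : Level
      A : Set a
      B : Set b

  module _ (_≟_ : DecidableEquality A) where
    open DecMembership _≟_ using (_∈?_)

    private
      without : A → List A → List A
      without y = filter (λ z → ¬? (z ≟ y))

      length-without : ∀ {y ys} → y ∈ ys → length (without y ys) < length ys
      length-without {y} {ys} y∈ys = filter-notAll (λ z → ¬? (z ≟ y)) ys (Any.map (λ y≡z z≢y → z≢y (sym y≡z)) y∈ys)

      ⊆-without : ∀ {xs ys y} → y ∉ xs → xs ⊆ ys → xs ⊆ without y ys
      ⊆-without y∉xs xs⊆ys z∈ = ∈-filter⁺ (λ z → ¬? (z ≟ _)) (xs⊆ys z∈) λ { refl → y∉xs z∈ }

    Unique-⊆⇒length≤ : ∀ {xs ys} → Unique xs → xs ⊆ ys → length xs ≤ length ys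
    Unique-⊆⇒length≤ {[]} _ _ = z≤n
    Unique-⊆⇒length≤ {x ∷ xs} {ys} (x≢xs ∷ !xs) xs⊆ys = begin
      suc (length xs)             ≤⟨ s≤s (Unique-⊆⇒length≤ !xs (⊆-without x∉xs (xs⊆ys ∘ there))) ⟩
      suc (length (without x ys)) ≤⟨ length-without (xs⊆ys (here refl)) ⟩
      length ys                   ∎
      where
      open ℕ.≤-Reasoning
      x∉xs : x ∉ xs
      x∉xs x∈xs = All.lookup x≢xs x∈xs refl

    Unique-⊆-length≥⇒⊇ : ∀ {xs ys} → Unique xs → xs ⊆ ys → length ys ≤ length xs → ys ⊆ xs
    Unique-⊆-length≥⇒⊇ {xs} {ys} !xs xs⊆ys ys≤xs {y} y∈ys with y ∈? xs
    ... | yes y∈xs = y∈xs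
    ... | no  y∉xs = contradiction ys≤xs (ℕ.<⇒≱ (begin-strict
      length xs             ≤⟨ Unique-⊆⇒length≤ !xs (⊆-without y∉xs xs⊆ys) ⟩
      length (without y ys) <⟨ length-without y∈ys ⟩
      length ys             ∎))
      where open ℕ.≤-Reasoning

  InjectiveOn : (A → B) → List A → Set _
  InjectiveOn f xs = ∀ {x y} → x ∈ xs → y ∈ xs → f x ≡ f y → x ≡ y

  Unique-map⁺ : ∀ (f : A → B) {xs} → InjectiveOn f xs → Unique xs → Unique (map f xs)
  Unique-map⁺ f inj [] = []
  Unique-map⁺ f {x ∷ xs} inj (x≢xs ∷ !xs) =
    AllP.map⁺ (All.tabulate λ y∈ fx≡fy → All.lookup x≢xs y∈ (inj (here refl) (there y∈) fx≡fy))
    ∷ Unique-map⁺ f (λ p q → inj (there p) (there q)) !xs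

  onto⇒injectiveOn : DecidableEquality A → DecidableEquality B →
    ∀ (f : A → B) xs {ys} → Unique ys → length xs ≤ length ys → ys ⊆ map f xs → InjectiveOn f xs
  onto⇒injectiveOn {A = A} _≟A_ _≟B_ f xs {ys} !ys xs≤ys ys⊆fxs {x₁} {x₂} x₁∈ x₂∈ fx₁≡fx₂
    with x₁ ≟A x₂
  ... | yes x₁≡x₂ = x₁≡x₂
  ... | no  x₁≢x₂ = contradiction xs≤ys (ℕ.<⇒≱ (begin-strict
      length ys                  ≤⟨ Unique-⊆⇒length≤ _≟B_ !ys ys⊆fxs′ ⟩
      length (map f xs′)         ≡⟨ length-map f xs′ ⟩
      length xs′                 <⟨ filter-notAll x≢? xs (Any.map (λ x₂≡z z≢x₂ → z≢x₂ (sym x₂≡z)) x₂∈) ⟩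
      length xs                  ∎))
    where
    open ℕ.≤-Reasoning
    x≢? : ∀ z → Dec (z ≢ x₂)
    x≢? z = ¬? (z ≟A x₂)
    xs′ : List A
    xs′ = filter x≢? xs
    ys⊆fxs′ : ys ⊆ map f xs′
    ys⊆fxs′ y∈ with ∈-map⁻ f (ys⊆fxs y∈)
    ... | z , z∈ , refl with z ≟A x₂
    ... | yes refl = subst (_∈ map f xs′) fx₁≡fx₂ (∈-map⁺ f (∈-filter⁺ x≢? x₁∈ x₁≢x₂))
    ... | no  z≢x₂ = ∈-map⁺ f (∈-filter⁺ x≢? z∈ z≢x₂)

  length-cartesianProductWith : ∀ {c} {C : Set c} (f : A → B → C) xs ys →
    length (cartesianProductWith f xs ys) ≡ length xs * length ys
  length-cartesianProductWith f [] ys = refl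
  length-cartesianProductWith f (x ∷ xs) ys = begin
    length (map (f x) ys ++ cartesianProductWith f xs ys)      ≡⟨ length-++ (map (f x) ys) ⟩
    length (map (f x) ys) + length (cartesianProductWith f xs ys)
      ≡⟨ cong₂ _+_ (length-map (f x) ys) (length-cartesianProductWith f xs ys) ⟩
    length ys + length xs * length ys                        ∎
    where open ≡-Reasoning

  vectorsOver : List A → (k : ℕ) → List (Vec A k)
  vectorsOver xs zero    = [] ∷ []
  vectorsOver xs (suc k) = cartesianProductWith _∷_ xs (vectorsOver xs k)

  length-vectorsOver : ∀ (xs : List A) k → length (vectorsOver xs k) ≡ length xs ^ k
  length-vectorsOver xs zero    = refl
  length-vectorsOver xs (suc k) =
    trans (length-cartesianProductWith _∷_ xs (vectorsOver xs k)) (cong (length xs *_) (length-vectorsOver xs k))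

  Unique-vectorsOver : ∀ {xs : List A} → Unique xs → ∀ k → Unique (vectorsOver xs k)
  Unique-vectorsOver !xs zero    = [] ∷ []
  Unique-vectorsOver !xs (suc k) = Unique.cartesianProductWith⁺ _∷_ ∷-injective !xs (Unique-vectorsOver !xs k)

  ∈-vectorsOver⁺ : ∀ {xs : List A} {k} (v : Vec A k) → (∀ i → lookup v i ∈ xs) → v ∈ vectorsOver xs k
  ∈-vectorsOver⁺ []      _   = here refl
  ∈-vectorsOver⁺ (x ∷ v) v∈ = ∈-cartesianProductWith⁺ _∷_ (v∈ zero) (∈-vectorsOver⁺ v (v∈ ∘ suc))

  ∈-vectorsOver⁻ : ∀ (xs : List A) {k} {v : Vec A k} → v ∈ vectorsOver xs k → ∀ i → lookup v i ∈ xs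
  ∈-vectorsOver⁻ xs {suc k} v∈ i with ∈-cartesianProductWith⁻ _∷_ xs (vectorsOver xs k) v∈
  ∈-vectorsOver⁻ xs {suc k} v∈ zero    | x , v , x∈ , v∈′ , refl = x∈
  ∈-vectorsOver⁻ xs {suc k} v∈ (suc i) | x , v , x∈ , v∈′ , refl = ∈-vectorsOver⁻ xs v∈′ i

  members : ∀ {n} → Subset n → List (Fin n)
  members []            = []
  members (inside  ∷ p) = zero ∷ map suc (members p)
  members (outside ∷ p) = map suc (members p)

  length-members : ∀ {n} (p : Subset n) → length (members p) ≡ ∣ p ∣
  length-members []            = refl
  length-members (inside  ∷ p) = cong suc (trans (length-map suc (members p)) (length-members p))
  length-members (outside ∷ p) = trans (length-map suc (members p)) (length-members p)

  Unique-members : ∀ {n} (p : Subset n) → Unique (members p)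
  Unique-members []            = []
  Unique-members (inside  ∷ p) =
    AllP.map⁺ (All.tabulate λ _ ()) ∷ Unique.map⁺ Fin-suc-injective (Unique-members p)
  Unique-members (outside ∷ p) = Unique.map⁺ Fin-suc-injective (Unique-members p)

  ∈-members : ∀ {n} {p : Subset n} {i} → i ∈ members p ⇔ i ∈ₛ p
  ∈-members = mk⇔ (to _ _) (from _ _)
    where
    to : ∀ {n} (p : Subset n) i → i ∈ members p → i ∈ₛ p
    to (inside  ∷ p) zero    _          = here
    to (inside  ∷ p) (suc i) (there i∈) with ∈-map⁻ suc i∈
    ... | j , j∈ , refl = there (to p j j∈)
    to (outside ∷ p) i       i∈         with ∈-map⁻ suc i∈
    ... | j , j∈ , refl = there (to p j j∈)
    from : ∀ {n} (p : Subset n) i → i ∈ₛ p → i ∈ members p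
    from (inside ∷ p) zero    here     = here refl
    from (inside ∷ p) (suc i) (there i∈) = there (∈-map⁺ suc (from p i i∈))
    from (outside ∷ p) (suc i) (there i∈) = ∈-map⁺ suc (from p i i∈)

  ∈-tabulate-does : ∀ {n p} {P : Fin n → Set p} (P? : ∀ i → Dec (P i)) {i} → i ∈ₛ tabulate (does ∘ P?) ⇔ P i
  ∈-tabulate-does {P = P} P? {i} = mk⇔ to (λ Pi → lookup⇒[]= i _ (trans (lookup∘tabulate (does ∘ P?) i) (dec-true (P? i) Pi)))
    where
    to : i ∈ₛ tabulate (does ∘ P?) → P i
    to i∈ with P? i | trans (sym (lookup∘tabulate (does ∘ P?) i)) ([]=⇒lookup i∈)
    ... | yes Pi | _ = Pi
    ... | no  _  | ()

  allSubsets : ∀ n → List (Subset n)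
  allSubsets = vectorsOver (inside ∷ outside ∷ [])

  Unique-allSubsets : ∀ n → Unique (allSubsets n)
  Unique-allSubsets = Unique-vectorsOver (((λ ()) ∷ []) ∷ [] ∷ [])

  ∈-allSubsets : ∀ {n} (p : Subset n) → p ∈ allSubsets n
  ∈-allSubsets p = ∈-vectorsOver⁺ p (λ i → bit (lookup p i))
    where
    bit : ∀ b → b ∈ inside ∷ outside ∷ []
    bit true  = here refl
    bit false = there (here refl)

  ∑-const : ∀ {n} c {f : Fin n → ℕ} → (∀ i → f i ≡ c) → ∑[ i < n ] f i ≡ n * c
  ∑-const {zero}  c f≡c = refl
  ∑-const {suc n} c f≡c = cong₂ _+_ (f≡c zero) (∑-const c (f≡c ∘ suc))

  ∑-allBut : ∀ {n} c (f : Fin n → ℕ) i₀ → (∀ i → i ≢ i₀ → f i ≡ c) → ∑[ i < n ] f i ≡ f i₀ + (n ∸ 1) * c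
  ∑-allBut {suc n} c f i₀ f≡c =
    trans (sum-remove {i = i₀} f) (cong (f i₀ +_) (∑-const c λ j → f≡c (punchIn i₀ j) (punchInᵢ≢i i₀ j)))

  𝟙 : ∀ {p} {P : Set p} → Dec P → ℕ
  𝟙 P? = if does P? then 1 else 0

  ∣p∣≡∑𝟙 : ∀ {n} (p : Subset n) → ∣ p ∣ ≡ ∑[ i < n ] 𝟙 (i ∈ₛ? p)
  ∣p∣≡∑𝟙 []            = refl
  ∣p∣≡∑𝟙 (inside  ∷ p) = cong suc (∣p∣≡∑𝟙 p)
  ∣p∣≡∑𝟙 (outside ∷ p) = ∣p∣≡∑𝟙 p

  length-filter-∷ : ∀ {p} {P : A → Set p} (P? : ∀ x → Dec (P x)) x xs →
    length (filter P? (x ∷ xs)) ≡ 𝟙 (P? x) + length (filter P? xs)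
  length-filter-∷ P? x xs with does (P? x)
  ... | true  = refl
  ... | false = refl

  incidences : ∀ {n} c (Ws : List (Subset n)) → All (λ W → ∣ W ∣ ≡ c) Ws →
    length Ws * c ≡ ∑[ i < n ] length (filter (i ∈ₛ?_) Ws)
  incidences {n} c [] [] = sym (trans (∑-const {n} 0 (λ _ → refl)) (ℕ.*-zeroʳ n))
  incidences {n} c (W ∷ Ws) (∣W∣≡c ∷ ∣Ws∣≡c) = begin
    c + length Ws * c
      ≡⟨ cong₂ _+_ (trans (sym ∣W∣≡c) (∣p∣≡∑𝟙 W)) (incidences c Ws ∣Ws∣≡c) ⟩
    ∑[ i < n ] 𝟙 (i ∈ₛ? W) + ∑[ i < n ] length (filter (i ∈ₛ?_) Ws)
      ≡⟨ sym (∑-distrib-+ (λ i → 𝟙 (i ∈ₛ? W)) _) ⟩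
    ∑[ i < n ] (𝟙 (i ∈ₛ? W) + length (filter (i ∈ₛ?_) Ws))
      ≡⟨ sum-cong-≗ (λ i → sym (length-filter-∷ (i ∈ₛ?_) W Ws)) ⟩
    ∑[ i < n ] length (filter (i ∈ₛ?_) (W ∷ Ws)) ∎
    where open ≡-Reasoning

  s*q≡s+k*t⇒s*[q∸1]≡t*k : ∀ s q k t → s * q ≡ s + k * t → s * (q ∸ 1) ≡ t * k
  s*q≡s+k*t⇒s*[q∸1]≡t*k s q k t sq≡s+kt = begin
    s * (q ∸ 1)      ≡⟨ ℕ.*-distribˡ-∸ s q 1 ⟩
    s * q ∸ s * 1    ≡⟨ cong₂ _∸_ sq≡s+kt (ℕ.*-identityʳ s) ⟩
    s + k * t ∸ s    ≡⟨ ℕ.m+n∸m≡n s (k * t) ⟩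
    k * t            ≡⟨ ℕ.*-comm k t ⟩
    t * k            ∎
    where open ≡-Reasoning

open Counting

open import Defs
open import Level using (_⊔_)
open import Data.Nat as ℕ using (ℕ; zero; suc; _^_; _∸_; _≤_; _<_; z≤n; s≤s; NonZero)
import Data.Nat.Properties as ℕ
open import Data.Nat.DivMod using (_/_; _%_; m<n*o⇒m/o<n; m%n<n; m≡m%n+[m/n]*n)
open import Data.Nat.Primality using (prime⇒nonTrivial)
import Data.Bool as Bool
open import Data.Fin using (Fin; zero; suc; toℕ; fromℕ<)
open import Data.Fin.Properties as Fin using (toℕ-fromℕ<)
open import Data.Fin.Subset using (Subset; ∣_∣) renaming (_∈_ to _∈ₛ_)
open import Data.Fin.Subset.Properties using (⊆-antisym) renaming (_∈?_ to _∈ₛ?_)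
open import Data.List using (List; length; filter; allFin) renaming (map to mapL)
open import Data.List.Properties using (length-map; length-tabulate; filter-all)
open import Data.List.Membership.Propositional using () renaming (_∈_ to _∈L_)
open import Data.List.Membership.Propositional.Properties
  using (∈-map⁺; ∈-map⁻; ∈-filter⁺; ∈-filter⁻; ∈-allFin; ∈-length)
open import Data.List.Relation.Binary.Subset.Propositional using (_⊆_)
open import Data.List.Relation.Unary.All as All using (All)
open import Data.List.Relation.Unary.Unique.Propositional using (Unique)
import Data.List.Relation.Unary.Unique.Propositional.Properties as Unique
open import Data.Vec using (Vec; []; _∷_; lookup; zipWith; map; replicate; tabulate)
open import Data.Vec.Properties using (lookup-zipWith; lookup-map; lookup-replicate; ≡-dec)
open import Data.Vec.Relation.Binary.Pointwise.Extensional using (ext; Pointwise-≡⇒≡)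
open import Data.Product using (∃; ∃-syntax; _×_; _,_; proj₁; proj₂)
open import Data.Sum using (_⊎_; inj₁; inj₂)
open import Function using (_∘_)
open import Function.Bundles using (_⇔_; mk⇔; Equivalence)
open import Relation.Nullary using (Dec; yes; no; ¬_; does; contradiction)
open import Relation.Nullary.Decidable using (map′; _×-dec_; _→-dec_)
open import Relation.Unary using (Decidable)
open import Relation.Binary.Definitions using (_Respects_)
import Relation.Binary.PropositionalEquality as ≡
open ≡ using (_≡_; _≢_)
open import Algebra.Bundles using (CommutativeRing)
open import Algebra.Properties.CommutativeMonoid.Sum ℕ.+-0-commutativeMonoid using (sum-syntax)


module LinearAlgebra {c ℓ} (K : CommutativeRing c ℓ) {N : ℕ}
                     (e : Fin N → CommutativeRing.Carrier K) where
  open CommutativeRing K hiding (zero)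
  open FieldTheory K e
  open import Relation.Binary.Reasoning.Setoid setoid
  open import Algebra.Solver.Ring.NaturalCoefficients.Default commutativeSemiring
    using (solve; _:+_; _:*_; _:=_)

  infix 4 _≋_
  record _≋_ {k} (u v : Vec Carrier k) : Set ℓ where
    constructor pointwise
    field ≋-lookup : ∀ i → lookup u i ≈ lookup v i
  open _≋_ public

  ≋-refl : ∀ {k} {u : Vec Carrier k} → u ≋ u
  ≋-refl = pointwise λ _ → refl

  ≋-sym : ∀ {k} {u v : Vec Carrier k} → u ≋ v → v ≋ u
  ≋-sym u≋v = pointwise (sym ∘ ≋-lookup u≋v)

  _∷-≋_ : ∀ {k x y} {u v : Vec Carrier k} → x ≈ y → u ≋ v → (x ∷ u) ≋ (y ∷ v)
  x≈y ∷-≋ u≋v = pointwise λ { zero → x≈y ; (suc i) → ≋-lookup u≋v i }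

  ≋-tail : ∀ {k x y} {u v : Vec Carrier k} → (x ∷ u) ≋ (y ∷ v) → u ≋ v
  ≋-tail xu≋yv = pointwise (≋-lookup xu≋yv ∘ suc)

  infixl 6 _+ⱽ_
  infixr 7 _·ⱽ_

  _+ⱽ_ : ∀ {k} → Vec Carrier k → Vec Carrier k → Vec Carrier k
  _+ⱽ_ = zipWith _+_

  _·ⱽ_ : ∀ {k} → Carrier → Vec Carrier k → Vec Carrier k
  a ·ⱽ u = map (a *_) u

  0ⱽ : ∀ {k} → Vec Carrier k
  0ⱽ = replicate _ 0#

  unit : ∀ {k} → Fin k → Carrier → Vec Carrier k
  unit zero    x = x ∷ 0ⱽ
  unit (suc j) x = 0# ∷ unit j x

  module _ {p} (S : Carrier → Set p) where

    +ⱽ-closed : (∀ {x y} → S x → S y → S (x + y)) → ∀ {k} (u v : Vec Carrier k) →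
      (∀ i → S (lookup u i)) → (∀ i → S (lookup v i)) → ∀ i → S (lookup (u +ⱽ v) i)
    +ⱽ-closed S+ u v u∈ v∈ i = ≡.subst S (≡.sym (lookup-zipWith _+_ i u v)) (S+ (u∈ i) (v∈ i))

    ·ⱽ-closed : ∀ {a} → (∀ {x} → S x → S (a * x)) → ∀ {k} (u : Vec Carrier k) →
      (∀ i → S (lookup u i)) → ∀ i → S (lookup (a ·ⱽ u) i)
    ·ⱽ-closed {a} S* u u∈ i = ≡.subst S (≡.sym (lookup-map i (a *_) u)) (S* (u∈ i))

    0ⱽ-closed : S 0# → ∀ {k} (i : Fin k) → S (lookup (0ⱽ {k}) i)
    0ⱽ-closed S0 i = ≡.subst S (≡.sym (lookup-replicate i 0#)) S0

    unit-closed : S 0# → ∀ {k} (j : Fin k) {x} → S x → ∀ i → S (lookup (unit j x) i)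
    unit-closed S0 zero    Sx zero    = Sx
    unit-closed S0 zero    Sx (suc i) = 0ⱽ-closed S0 i
    unit-closed S0 (suc j) Sx zero    = S0
    unit-closed S0 (suc j) Sx (suc i) = unit-closed S0 j Sx i

  +-interchange : ∀ a b c d → (a + b) + (c + d) ≈ (a + c) + (b + d)
  +-interchange = solve 4 (λ a b c d → (a :+ b) :+ (c :+ d) := (a :+ c) :+ (b :+ d)) refl

  *-left-comm : ∀ a b c → a * (b * c) ≈ b * (a * c)
  *-left-comm = solve 3 (λ a b c → a :* (b :* c) := b :* (a :* c)) refl

  lincomb-cong : ∀ {k} {cs cs′ vs vs′ : Vec Carrier k} → cs ≋ cs′ → vs ≋ vs′ →
    lincomb cs vs ≈ lincomb cs′ vs′
  lincomb-cong {cs = []}     {[]}      {[]}     {[]}      _ _ = refl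
  lincomb-cong {cs = _ ∷ cs} {_ ∷ cs′} {_ ∷ vs} {_ ∷ vs′} p q =
    +-cong (*-cong (≋-lookup p zero) (≋-lookup q zero)) (lincomb-cong (≋-tail p) (≋-tail q))

  lincomb-+ⱽ : ∀ {k} (cs ds vs : Vec Carrier k) → lincomb (cs +ⱽ ds) vs ≈ lincomb cs vs + lincomb ds vs
  lincomb-+ⱽ []       []       []       = sym (+-identityˡ 0#)
  lincomb-+ⱽ (c ∷ cs) (d ∷ ds) (v ∷ vs) =
    trans (+-cong (distribʳ v c d) (lincomb-+ⱽ cs ds vs)) (+-interchange _ _ _ _)

  lincomb-·ⱽˡ : ∀ {k} a (cs vs : Vec Carrier k) → lincomb (a ·ⱽ cs) vs ≈ a * lincomb cs vs
  lincomb-·ⱽˡ a []       []       = sym (zeroʳ a)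
  lincomb-·ⱽˡ a (c ∷ cs) (v ∷ vs) =
    trans (+-cong (*-assoc a c v) (lincomb-·ⱽˡ a cs vs)) (sym (distribˡ a _ _))

  lincomb-·ⱽʳ : ∀ {k} a (cs vs : Vec Carrier k) → lincomb cs (a ·ⱽ vs) ≈ a * lincomb cs vs
  lincomb-·ⱽʳ a []       []       = sym (zeroʳ a)
  lincomb-·ⱽʳ a (c ∷ cs) (v ∷ vs) =
    trans (+-cong (*-left-comm c a v) (lincomb-·ⱽʳ a cs vs)) (sym (distribˡ a _ _))

  lincomb-0ⱽ : ∀ {k} (vs : Vec Carrier k) → lincomb 0ⱽ vs ≈ 0#
  lincomb-0ⱽ []       = refl
  lincomb-0ⱽ (v ∷ vs) = trans (+-cong (zeroˡ v) (lincomb-0ⱽ vs)) (+-identityˡ 0#)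

  lincomb-unit : ∀ {k} (j : Fin k) x (vs : Vec Carrier k) → lincomb (unit j x) vs ≈ x * lookup vs j
  lincomb-unit {suc k} zero x (v ∷ vs) = trans (+-congˡ (lincomb-0ⱽ {k} vs)) (+-identityʳ (x * v))
  lincomb-unit (suc j) x (v ∷ vs) =
    trans (+-congʳ (zeroˡ v)) (trans (+-identityˡ _) (lincomb-unit j x vs))

  ^′-+ : ∀ α a b → α ^′ (a ℕ.+ b) ≈ (α ^′ a) * (α ^′ b)
  ^′-+ α zero    b = sym (*-identityˡ _)
  ^′-+ α (suc a) b = trans (*-congˡ (^′-+ α a b)) (sym (*-assoc _ _ _))

  module _ (α : Carrier) where

    private
      ∑-tabulate-cong : ∀ {k} {f g : Fin k → Carrier} → (∀ i → f i ≈ g i) →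
        ∑ (tabulate f) ≈ ∑ (tabulate g)
      ∑-tabulate-cong {zero}  f≈g = refl
      ∑-tabulate-cong {suc k} f≈g = +-cong (f≈g zero) (∑-tabulate-cong (f≈g ∘ suc))

      ∑-tabulate-* : ∀ {k} a (f : Fin k → Carrier) → ∑ (tabulate (λ i → a * f i)) ≈ a * ∑ (tabulate f)
      ∑-tabulate-* {zero}  a f = sym (zeroʳ a)
      ∑-tabulate-* {suc k} a f = trans (+-congˡ (∑-tabulate-* a (f ∘ suc))) (sym (distribˡ a _ _))

    αsum-∷ : ∀ {k} x (w : Vec Carrier k) → αsum α (x ∷ w) ≈ x + α * αsum α w
    αsum-∷ {k} x w = +-cong (*-identityˡ x)
      (trans (∑-tabulate-cong (λ i → *-assoc α _ (lookup w i)))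
             (∑-tabulate-* {k} α (λ i → (α ^′ toℕ i) * lookup w i)))

    αsum-cong : ∀ {k} {w w′ : Vec Carrier k} → w ≋ w′ → αsum α w ≈ αsum α w′
    αsum-cong {w = []}    {[]}     _ = refl
    αsum-cong {w = x ∷ w} {y ∷ w′} p = begin
      αsum α (x ∷ w)    ≈⟨ αsum-∷ x w ⟩
      x + α * αsum α w  ≈⟨ +-cong (≋-lookup p zero) (*-congˡ (αsum-cong (≋-tail p))) ⟩
      y + α * αsum α w′ ≈⟨ αsum-∷ y w′ ⟨
      αsum α (y ∷ w′)   ∎

    αsum-+ⱽ : ∀ {k} (u v : Vec Carrier k) → αsum α (u +ⱽ v) ≈ αsum α u + αsum α v
    αsum-+ⱽ []      []      = sym (+-identityˡ 0#)
    αsum-+ⱽ (x ∷ u) (y ∷ v) = begin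
      αsum α ((x ∷ u) +ⱽ (y ∷ v))              ≈⟨ αsum-∷ (x + y) (u +ⱽ v) ⟩
      (x + y) + α * αsum α (u +ⱽ v)            ≈⟨ +-congˡ (*-congˡ (αsum-+ⱽ u v)) ⟩
      (x + y) + α * (αsum α u + αsum α v)      ≈⟨ +-congˡ (distribˡ α _ _) ⟩
      (x + y) + (α * αsum α u + α * αsum α v)  ≈⟨ +-interchange _ _ _ _ ⟩
      (x + α * αsum α u) + (y + α * αsum α v)  ≈⟨ +-cong (αsum-∷ x u) (αsum-∷ y v) ⟨
      αsum α (x ∷ u) + αsum α (y ∷ v)          ∎

    αsum-·ⱽ : ∀ {k} a (u : Vec Carrier k) → αsum α (a ·ⱽ u) ≈ a * αsum α u
    αsum-·ⱽ a []      = sym (zeroʳ a)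
    αsum-·ⱽ a (x ∷ u) = begin
      αsum α (a ·ⱽ (x ∷ u))       ≈⟨ αsum-∷ (a * x) (a ·ⱽ u) ⟩
      a * x + α * αsum α (a ·ⱽ u) ≈⟨ +-congˡ (*-congˡ (αsum-·ⱽ a u)) ⟩
      a * x + α * (a * αsum α u)  ≈⟨ +-congˡ (*-left-comm α a _) ⟩
      a * x + a * (α * αsum α u)  ≈⟨ distribˡ a _ _ ⟨
      a * (x + α * αsum α u)      ≈⟨ *-congˡ (αsum-∷ x u) ⟨
      a * αsum α (x ∷ u)          ∎

    αsum-0ⱽ : ∀ {k} → αsum α (0ⱽ {k}) ≈ 0#
    αsum-0ⱽ {zero}  = refl
    αsum-0ⱽ {suc k} = begin
      αsum α (0# ∷ 0ⱽ {k})     ≈⟨ αsum-∷ 0# (0ⱽ {k}) ⟩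
      0# + α * αsum α (0ⱽ {k}) ≈⟨ +-identityˡ _ ⟩
      α * αsum α (0ⱽ {k})      ≈⟨ *-congˡ (αsum-0ⱽ {k}) ⟩
      α * 0#                   ≈⟨ zeroʳ α ⟩
      0#                       ∎

    αsum-unit : ∀ {k} (j : Fin k) x → αsum α (unit j x) ≈ (α ^′ toℕ j) * x
    αsum-unit {suc k} zero x = begin
      αsum α (x ∷ 0ⱽ {k})     ≈⟨ αsum-∷ x (0ⱽ {k}) ⟩
      x + α * αsum α (0ⱽ {k}) ≈⟨ +-congˡ (trans (*-congˡ (αsum-0ⱽ {k})) (zeroʳ α)) ⟩
      x + 0#                  ≈⟨ +-identityʳ x ⟩
      x                       ≈⟨ *-identityˡ x ⟨
      1# * x                  ∎
    αsum-unit (suc j) x = begin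
      αsum α (0# ∷ unit j x)     ≈⟨ αsum-∷ 0# (unit j x) ⟩
      0# + α * αsum α (unit j x) ≈⟨ +-identityˡ _ ⟩
      α * αsum α (unit j x)      ≈⟨ *-congˡ (αsum-unit j x) ⟩
      α * ((α ^′ toℕ j) * x)     ≈⟨ *-assoc _ _ _ ⟨
      α * (α ^′ toℕ j) * x       ∎

module Enumeration {c ℓ} (K : CommutativeRing c ℓ) {N : ℕ}
                   (e : Fin N → CommutativeRing.Carrier K)
                   (isE : FieldTheory.IsEnumeration K e) where
  open CommutativeRing K hiding (zero)
  open FieldTheory K e
  open LinearAlgebra K e

  idx : Carrier → Fin N
  idx x = proj₁ (proj₂ isE x)

  e∘idx : ∀ x → e (idx x) ≈ x
  e∘idx x = proj₂ (proj₂ isE x)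

  e-injective : ∀ {i j} → e i ≈ e j → i ≡ j
  e-injective = proj₁ isE _ _

  idx∘e : ∀ i → idx (e i) ≡ i
  idx∘e i = e-injective (e∘idx (e i))

  idx-cong : ∀ {x y} → x ≈ y → idx x ≡ idx y
  idx-cong {x} {y} x≈y = e-injective (trans (e∘idx x) (trans x≈y (sym (e∘idx y))))

  idx-injective : ∀ {x y} → idx x ≡ idx y → x ≈ y
  idx-injective {x} {y} eq = trans (sym (e∘idx x)) (trans (reflexive (≡.cong e eq)) (e∘idx y))

  _≈?_ : ∀ x y → Dec (x ≈ y)
  x ≈? y = map′ idx-injective idx-cong (idx x Fin.≟ idx y)

  ∈⇔idx∈ : ∀ {x S} → x ∈ S ⇔ idx x ∈ₛ S
  ∈⇔idx∈ {x} {S} = mk⇔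
    (λ (i , i∈S , eᵢ≈x) → ≡.subst (_∈ₛ S) (≡.sym (≡.trans (idx-cong (sym eᵢ≈x)) (idx∘e i))) i∈S)
    (λ idx∈S → idx x , idx∈S , e∘idx x)

  e∈⇔∈ₛ : ∀ {i S} → e i ∈ S ⇔ i ∈ₛ S
  e∈⇔∈ₛ {i} {S} = mk⇔ (≡.subst (_∈ₛ S) (idx∘e i) ∘ Equivalence.to ∈⇔idx∈) (λ i∈S → i , i∈S , refl)

  ∈-resp-≈ : ∀ {S} → (_∈ S) Respects _≈_
  ∈-resp-≈ x≈y (i , i∈S , eᵢ≈x) = i , i∈S , trans eᵢ≈x x≈y

  _∈?_ : ∀ x S → Dec (x ∈ S)
  x ∈? S = map′ (Equivalence.from ∈⇔idx∈) (Equivalence.to ∈⇔idx∈) (idx x ∈ₛ? S)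

  ∀? : ∀ {p} {P : Carrier → Set p} → P Respects _≈_ → Decidable P → Dec (∀ x → P x)
  ∀? resp P? = map′ (λ ∀P x → resp (e∘idx x) (∀P (idx x))) (λ ∀P → ∀P ∘ e) (Fin.all? (P? ∘ e))

  ∃? : ∀ {p} {P : Carrier → Set p} → P Respects _≈_ → Decidable P → Dec (∃ P)
  ∃? resp P? = map′ (λ (i , Peᵢ) → e i , Peᵢ) (λ (x , Px) → idx x , resp (sym (e∘idx x)) Px)
                    (Fin.any? (P? ∘ e))

  ∀ⱽ? : ∀ {k p} {P : Vec Carrier k → Set p} → P Respects _≋_ → Decidable P → Dec (∀ v → P v)
  ∀ⱽ? {zero}  resp P? = map′ (λ { P[] [] → P[] }) (λ ∀P → ∀P []) (P? [])
  ∀ⱽ? {suc k} resp P? =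
    map′ (λ { ∀P (x ∷ v) → ∀P x v }) (λ ∀P x v → ∀P (x ∷ v))
      (∀? (λ x≈y ∀P v → resp (x≈y ∷-≋ ≋-refl) (∀P v))
          (λ x → ∀ⱽ? (λ u≋v → resp (refl ∷-≋ u≋v)) (λ v → P? (x ∷ v))))

  ∃ⱽ? : ∀ {k p} {P : Vec Carrier k → Set p} → P Respects _≋_ → Decidable P → Dec (∃ P)
  ∃ⱽ? {zero}  resp P? = map′ ([] ,_) (λ { ([] , P[]) → P[] }) (P? [])
  ∃ⱽ? {suc k} resp P? =
    map′ (λ { (x , v , P) → x ∷ v , P }) (λ { (x ∷ v , P) → x , v , P })
      (∃? (λ x≈y (v , P) → v , resp (x≈y ∷-≋ ≋-refl) P)
          (λ x → ∃ⱽ? (λ u≋v → resp (refl ∷-≋ u≋v)) (λ v → P? (x ∷ v))))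

  _∈ⱽ_ : ∀ {k} → Vec Carrier k → Subset N → Set ℓ
  w ∈ⱽ S = ∀ i → lookup w i ∈ S

  ∈ⱽ-resp-≋ : ∀ {k S} → (λ (w : Vec Carrier k) → w ∈ⱽ S) Respects _≋_
  ∈ⱽ-resp-≋ u≋v u∈S i = ∈-resp-≈ (≋-lookup u≋v i) (u∈S i)

  _∈ⱽ?_ : ∀ {k} (w : Vec Carrier k) S → Dec (w ∈ⱽ S)
  w ∈ⱽ? S = Fin.all? (λ i → lookup w i ∈? S)

  Congruent : ∀ {k} → (Vec Carrier k → Carrier) → Set (c ⊔ ℓ)
  Congruent Φ = ∀ {u v} → u ≋ v → Φ u ≈ Φ v

  Image : ∀ {k} → (Vec Carrier k → Carrier) → Subset N → Carrier → Set (c ⊔ ℓ)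
  Image Φ S x = ∃[ w ] (w ∈ⱽ S × Φ w ≈ x)

  Image-resp-≈ : ∀ {k} {Φ : Vec Carrier k → Carrier} {S} → Image Φ S Respects _≈_
  Image-resp-≈ x≈y (w , w∈S , Φw≈x) = w , w∈S , trans Φw≈x x≈y

  Injectiveⱽ : ∀ {k} → (Vec Carrier k → Carrier) → Subset N → Set (c ⊔ ℓ)
  Injectiveⱽ Φ S = ∀ w w′ → w ∈ⱽ S → w′ ∈ⱽ S → Φ w ≈ Φ w′ → ∀ i → lookup w i ≈ lookup w′ i

  module _ {k} {Φ : Vec Carrier k → Carrier} (Φ-cong : Congruent Φ) where

    Image? : ∀ S x → Dec (Image Φ S x)
    Image? S x = ∃ⱽ? (λ u≋v (u∈S , Φu≈x) → ∈ⱽ-resp-≋ u≋v u∈S , trans (Φ-cong (≋-sym u≋v)) Φu≈x)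
                     (λ w → w ∈ⱽ? S ×-dec Φ w ≈? x)

    Injectiveⱽ? : ∀ S → Dec (Injectiveⱽ Φ S)
    Injectiveⱽ? S = ∀ⱽ? resp₁ λ w → ∀ⱽ? (resp₂ w) λ w′ →
      w ∈ⱽ? S →-dec w′ ∈ⱽ? S →-dec Φ w ≈? Φ w′ →-dec Fin.all? λ i → lookup w i ≈? lookup w′ i
      where
      resp₁ : (λ w → ∀ w′ → w ∈ⱽ S → w′ ∈ⱽ S → Φ w ≈ Φ w′ → ∀ i → lookup w i ≈ lookup w′ i) Respects _≋_
      resp₁ u≋v inj w′ v∈S w′∈S Φv≈Φw′ i = trans (sym (≋-lookup u≋v i))
        (inj w′ (∈ⱽ-resp-≋ (≋-sym u≋v) v∈S) w′∈S (trans (Φ-cong u≋v) Φv≈Φw′) i)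
      resp₂ : ∀ w → (λ w′ → w ∈ⱽ S → w′ ∈ⱽ S → Φ w ≈ Φ w′ → ∀ i → lookup w i ≈ lookup w′ i) Respects _≋_
      resp₂ w u≋v inj w∈S v∈S Φw≈Φv i = trans
        (inj w∈S (∈ⱽ-resp-≋ (≋-sym u≋v) v∈S) (trans Φw≈Φv (Φ-cong (≋-sym u≋v))) i) (≋-lookup u≋v i)

    private
      coordinates : ∀ {w : Vec Carrier k} {S} → w ∈ⱽ S →
        ∃ λ is → is ∈L vectorsOver (members S) k × map e is ≋ w
      coordinates {w} {S} w∈S = map idx w
        , ∈-vectorsOver⁺ _ (λ i → Equivalence.from ∈-members
            (≡.subst (_∈ₛ S) (≡.sym (lookup-map i idx w)) (Equivalence.to ∈⇔idx∈ (w∈S i))))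
        , pointwise λ i → trans (reflexive (≡.trans (lookup-map i e (map idx w)) (≡.cong e (lookup-map i idx w))))
                                (e∘idx _)

      fromCoordinates : ∀ {S is} → is ∈L vectorsOver (members S) k → map e is ∈ⱽ S
      fromCoordinates {S} {is} is∈ i = ≡.subst (_∈ S) (≡.sym (lookup-map i e is))
        (Equivalence.from e∈⇔∈ₛ (Equivalence.to ∈-members (∈-vectorsOver⁻ (members S) is∈ i)))

      length-coordinates : ∀ (S : Subset N) → length (vectorsOver (members S) k) ≡ ∣ S ∣ ^ k
      length-coordinates S = ≡.trans (length-vectorsOver (members S) k) (≡.cong (_^ k) (length-members S))

    image : Subset N → List (Fin N)
    image S = mapL (idx ∘ Φ ∘ map e) (vectorsOver (members S) k)

    length-image : ∀ S → length (image S) ≡ ∣ S ∣ ^ k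
    length-image S = ≡.trans (length-map _ (vectorsOver (members S) k)) (length-coordinates S)

    Image⇒∈image : ∀ {S x} → Image Φ S x → idx x ∈L image S
    Image⇒∈image {S} (w , w∈S , Φw≈x) with coordinates w∈S
    ... | is , is∈ , eis≋w = ≡.subst (_∈L image S) (idx-cong (trans (Φ-cong eis≋w) Φw≈x))
                                      (∈-map⁺ (idx ∘ Φ ∘ map e) is∈)

    Unique-image : ∀ {S} → Injectiveⱽ Φ S → Unique (image S)
    Unique-image {S} inj = Unique-map⁺ _ injOn (Unique-vectorsOver (Unique-members S) k)
      where
      injOn : InjectiveOn (idx ∘ Φ ∘ map e) (vectorsOver (members S) k)
      injOn {is} {js} is∈ js∈ eq = Pointwise-≡⇒≡ (ext λ i → e-injective (begin
        e (lookup is i)       ≡⟨ lookup-map i e is ⟨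
        lookup (map e is) i   ≈⟨ inj _ _ (fromCoordinates is∈) (fromCoordinates js∈) (idx-injective eq) i ⟩
        lookup (map e js) i   ≡⟨ lookup-map i e js ⟩
        e (lookup js i)       ∎))
        where open import Relation.Binary.Reasoning.Setoid setoid

    covered⇒length≤ : ∀ {S ys} → Unique ys → (∀ {j} → j ∈L ys → Image Φ S (e j)) → length ys ≤ ∣ S ∣ ^ k
    covered⇒length≤ {S} {ys} !ys ys⊆Φ[S] = ℕ.≤-trans
      (Unique-⊆⇒length≤ Fin._≟_ !ys (λ {j} j∈ → ≡.subst (_∈L image S) (idx∘e j) (Image⇒∈image (ys⊆Φ[S] j∈))))
      (ℕ.≤-reflexive (length-image S))

    injective⇒length≥ : ∀ {S ys} → Injectiveⱽ Φ S → (∀ w → w ∈ⱽ S → idx (Φ w) ∈L ys) → ∣ S ∣ ^ k ≤ length ys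
    injective⇒length≥ {S} {ys} inj Φ[S]⊆ys = ℕ.≤-trans (ℕ.≤-reflexive (≡.sym (length-image S)))
      (Unique-⊆⇒length≤ Fin._≟_ (Unique-image inj) image⊆ys)
      where
      image⊆ys : image S ⊆ ys
      image⊆ys j∈ with ∈-map⁻ _ j∈
      ... | is , is∈ , ≡.refl = Φ[S]⊆ys _ (fromCoordinates is∈)

    onto⇒injective : ∀ {S ys} → Unique ys → ∣ S ∣ ^ k ≤ length ys →
      (∀ {j} → j ∈L ys → Image Φ S (e j)) → Injectiveⱽ Φ S
    onto⇒injective {S} {ys} !ys S^k≤ys ys⊆Φ[S] w w′ w∈S w′∈S Φw≈Φw′ i
      with coordinates w∈S | coordinates w′∈S
    ... | is , is∈ , eis≋w | js , js∈ , ejs≋w′ = begin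
      lookup w i          ≈⟨ ≋-lookup eis≋w i ⟨
      lookup (map e is) i ≡⟨ ≡.cong (λ v → lookup (map e v) i) is≡js ⟩
      lookup (map e js) i ≈⟨ ≋-lookup ejs≋w′ i ⟩
      lookup w′ i         ∎
      where
      open import Relation.Binary.Reasoning.Setoid setoid
      is≡js : is ≡ js
      is≡js = onto⇒injectiveOn (≡-dec Fin._≟_) Fin._≟_ (idx ∘ Φ ∘ map e) _ !ys
        (ℕ.≤-trans (ℕ.≤-reflexive (length-coordinates S)) S^k≤ys)
        (λ {j} j∈ → ≡.subst (_∈L image S) (idx∘e j) (Image⇒∈image (ys⊆Φ[S] j∈)))
        is∈ js∈ (idx-cong (trans (Φ-cong eis≋w) (trans Φw≈Φw′ (Φ-cong (≋-sym ejs≋w′)))))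

module Subspaces {c ℓ} (K : CommutativeRing c ℓ) {N : ℕ}
                 (e : Fin N → CommutativeRing.Carrier K)
                 (isE : FieldTheory.IsEnumeration K e)
                 (F : Subset N) (isSubfield : FieldTheory.IsSubfield K e F) where
  open CommutativeRing K hiding (zero)
  open FieldTheory K e
  open LinearAlgebra K e
  open Enumeration K e isE
  open import Relation.Binary.Reasoning.Setoid setoid
  open import Algebra.Properties.Ring ring using (-1*x≈-x)
  open import Algebra.Properties.Group +-group using (x∙y⁻¹≈ε⇒x≈y)

  0∈F : 0# ∈ F
  0∈F = proj₁ isSubfield

  1∈F : 1# ∈ F
  1∈F = proj₁ (proj₂ isSubfield)

  +∈F : ∀ {x y} → x ∈ F → y ∈ F → (x + y) ∈ F
  +∈F = proj₁ (proj₂ (proj₂ isSubfield)) _ _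

  -∈F : ∀ {x} → x ∈ F → (- x) ∈ F
  -∈F = proj₁ (proj₂ (proj₂ (proj₂ isSubfield))) _

  *∈F : ∀ {x y} → x ∈ F → y ∈ F → (x * y) ∈ F
  *∈F = proj₁ (proj₂ (proj₂ (proj₂ (proj₂ isSubfield)))) _ _

  ⁻¹∈F : ∀ {x y} → x ∈ F → ¬ (x ≈ 0#) → x * y ≈ 1# → y ∈ F
  ⁻¹∈F = proj₂ (proj₂ (proj₂ (proj₂ (proj₂ isSubfield)))) _ _

  record LinearlyClosed {p} (S : Carrier → Set p) : Set (c ⊔ ℓ ⊔ p) where
    field
      0-closed : S 0#
      +-closed : ∀ {x y} → S x → S y → S (x + y)
      ·-closed : ∀ {a x} → a ∈ F → S x → S (a * x)

  lincomb-closed : ∀ {p} {S : Carrier → Set p} → LinearlyClosed S →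
    ∀ {k} (cs vs : Vec Carrier k) → cs ∈ⱽ F → (∀ i → S (lookup vs i)) → S (lincomb cs vs)
  lincomb-closed S-closed []       []       _    _    = LinearlyClosed.0-closed S-closed
  lincomb-closed S-closed (c ∷ cs) (v ∷ vs) cs∈F vs∈S = LinearlyClosed.+-closed S-closed
    (LinearlyClosed.·-closed S-closed (cs∈F zero) (vs∈S zero))
    (lincomb-closed S-closed cs vs (cs∈F ∘ suc) (vs∈S ∘ suc))

  subspace⇒linearlyClosed : ∀ {W} → IsSubspace F W → LinearlyClosed (_∈ W)
  subspace⇒linearlyClosed (0∈W , +∈W , ·∈W) = record
    { 0-closed = 0∈W ; +-closed = +∈W _ _ ; ·-closed = ·∈W _ _ }

  Span : ∀ {k} → Vec Carrier k → Carrier → Set (c ⊔ ℓ)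
  Span v = Image (λ cs → lincomb cs v) F

  lincomb-congˡ : ∀ {k} {vs : Vec Carrier k} → Congruent (λ cs → lincomb cs vs)
  lincomb-congˡ cs≋cs′ = lincomb-cong cs≋cs′ ≋-refl

  Span-linearlyClosed : ∀ {k} (v : Vec Carrier k) → LinearlyClosed (Span v)
  Span-linearlyClosed v = record
    { 0-closed = 0ⱽ , 0ⱽ-closed (_∈ F) 0∈F , lincomb-0ⱽ v
    ; +-closed = λ (cs , cs∈F , csv≈x) (ds , ds∈F , dsv≈y) →
        cs +ⱽ ds , +ⱽ-closed (_∈ F) +∈F cs ds cs∈F ds∈F , trans (lincomb-+ⱽ cs ds v) (+-cong csv≈x dsv≈y)
    ; ·-closed = λ a∈F (cs , cs∈F , csv≈x) →
        _ ·ⱽ cs , ·ⱽ-closed (_∈ F) (*∈F a∈F) cs cs∈F , trans (lincomb-·ⱽˡ _ cs v) (*-congˡ csv≈x)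
    }

  Span-lookup : ∀ {k} (v : Vec Carrier k) i → Span v (lookup v i)
  Span-lookup v i = unit i 1# , unit-closed (_∈ F) 0∈F i 1∈F , trans (lincomb-unit i 1# v) (*-identityˡ _)

  Span-mono : ∀ {k l} {u : Vec Carrier k} {v : Vec Carrier l} → (∀ i → Span u (lookup v i)) →
    ∀ {x} → Span v x → Span u x
  Span-mono {u = u} {v} v⊆⟨u⟩ (cs , cs∈F , csv≈x) =
    Image-resp-≈ csv≈x (lincomb-closed (Span-linearlyClosed u) cs v cs∈F v⊆⟨u⟩)

  Span-cong : ∀ {k} {u v : Vec Carrier k} → u ≋ v → ∀ {x} → Span u x → Span v x
  Span-cong {v = v} u≋v = Span-mono (λ i → Image-resp-≈ (sym (≋-lookup u≋v i)) (Span-lookup v i))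

  Span? : ∀ {k} (v : Vec Carrier k) x → Dec (Span v x)
  Span? v = Image? lincomb-congˡ F

  descending : (ℕ → Carrier) → (k : ℕ) → Vec Carrier k
  descending f zero    = []
  descending f (suc k) = f k ∷ descending f k

  lookup-descending : ∀ f k i → ∃[ j ] (j < k × lookup (descending f k) i ≡ f j)
  lookup-descending f (suc k) zero    = k , ℕ.≤-refl , ≡.refl
  lookup-descending f (suc k) (suc i) =
    let j , j<k , eq = lookup-descending f k i in j , ℕ.m<n⇒m<1+n j<k , eq

  Span-descending : ∀ f {j k} → j < k → Span (descending f k) (f j)
  Span-descending f {j} {suc k} (s≤s j≤k) with j ℕ.≟ k
  ... | yes ≡.refl = Span-lookup (descending f (suc k)) zero
  ... | no  j≢k    = Span-mono (Span-lookup (descending f (suc k)) ∘ suc) (Span-descending f (ℕ.≤∧≢⇒< j≤k j≢k))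

  spanSet : ∀ {k} → Vec Carrier k → Subset N
  spanSet v = tabulate (λ j → does (Span? v (e j)))

  ∈spanSet⇔Span : ∀ {k} {v : Vec Carrier k} {x} → x ∈ spanSet v ⇔ Span v x
  ∈spanSet⇔Span {v = v} {x} = mk⇔
    (Image-resp-≈ (e∘idx x) ∘ Equivalence.to span∋ ∘ Equivalence.to ∈⇔idx∈)
    (Equivalence.from ∈⇔idx∈ ∘ Equivalence.from span∋ ∘ Image-resp-≈ (sym (e∘idx x)))
    where
    span∋ : ∀ {j} → j ∈ₛ spanSet v ⇔ Span v (e j)
    span∋ = ∈-tabulate-does (Span? v ∘ e)

  spanSet-subspace : ∀ {k} (v : Vec Carrier k) → IsSubspace F (spanSet v)
  spanSet-subspace v =
      from 0-closed
    , (λ _ _ x∈ y∈ → from (+-closed (to x∈) (to y∈)))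
    , (λ _ _ a∈F x∈ → from (·-closed a∈F (to x∈)))
    where
    open LinearlyClosed (Span-linearlyClosed v)
    to : ∀ {x} → x ∈ spanSet v → Span v x
    to = Equivalence.to ∈spanSet⇔Span
    from : ∀ {x} → Span v x → x ∈ spanSet v
    from = Equivalence.from ∈spanSet⇔Span

  Independent : ∀ {k} → Vec Carrier k → Set (c ⊔ ℓ)
  Independent v = ∀ cs → cs ∈ⱽ F → lincomb cs v ≈ 0# → ∀ i → lookup cs i ≈ 0#

  Independent⇔Injectiveⱽ : ∀ {k} {v : Vec Carrier k} → Independent v ⇔ Injectiveⱽ (λ cs → lincomb cs v) F
  Independent⇔Injectiveⱽ {v = v} = mk⇔ to from
    where
    to : Independent v → Injectiveⱽ (λ cs → lincomb cs v) F
    to indep w w′ w∈F w′∈F wv≈w′v i = x∙y⁻¹≈ε⇒x≈y _ _ (begin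
      lookup w i + - lookup w′ i         ≈⟨ +-congˡ (-1*x≈-x _) ⟨
      lookup w i + - 1# * lookup w′ i    ≡⟨ ≡.cong₂ _+_ ≡.refl (lookup-map i _ w′) ⟨
      lookup w i + lookup (- 1# ·ⱽ w′) i ≡⟨ lookup-zipWith _+_ i w _ ⟨
      lookup (w +ⱽ - 1# ·ⱽ w′) i         ≈⟨ indep (w +ⱽ - 1# ·ⱽ w′) d∈F dv≈0 i ⟩
      0#                                 ∎)
      where
      d∈F : (w +ⱽ - 1# ·ⱽ w′) ∈ⱽ F
      d∈F = +ⱽ-closed (_∈ F) +∈F w _ w∈F (·ⱽ-closed (_∈ F) (*∈F (-∈F 1∈F)) w′ w′∈F)
      dv≈0 : lincomb (w +ⱽ - 1# ·ⱽ w′) v ≈ 0#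
      dv≈0 = begin
        lincomb (w +ⱽ - 1# ·ⱽ w′) v          ≈⟨ lincomb-+ⱽ w _ v ⟩
        lincomb w v + lincomb (- 1# ·ⱽ w′) v  ≈⟨ +-congˡ (lincomb-·ⱽˡ (- 1#) w′ v) ⟩
        lincomb w v + - 1# * lincomb w′ v     ≈⟨ +-congˡ (-1*x≈-x _) ⟩
        lincomb w v + - lincomb w′ v          ≈⟨ +-congʳ wv≈w′v ⟩
        lincomb w′ v + - lincomb w′ v         ≈⟨ -‿inverseʳ _ ⟩
        0#                                    ∎
    from : Injectiveⱽ (λ cs → lincomb cs v) F → Independent v
    from inj cs cs∈F cs≈0 i = trans (inj cs 0ⱽ cs∈F (0ⱽ-closed (_∈ F) 0∈F) (trans cs≈0 (sym (lincomb-0ⱽ v))) i)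
                                    (reflexive (lookup-replicate i 0#))

  Independent? : ∀ {k} (v : Vec Carrier k) → Dec (Independent v)
  Independent? v = map′ (Equivalence.from Independent⇔Injectiveⱽ) (Equivalence.to Independent⇔Injectiveⱽ)
                        (Injectiveⱽ? lincomb-congˡ F)

  Independent-cong : ∀ {k} {u v : Vec Carrier k} → u ≋ v → Independent u → Independent v
  Independent-cong u≋v indep cs cs∈F csv≈0 = indep cs cs∈F (trans (lincomb-cong (≋-refl {u = cs}) u≋v) csv≈0)

  Independent⇒∣F∣^k≤N : ∀ {k} {v : Vec Carrier k} → Independent v → ∣ F ∣ ^ k ≤ N
  Independent⇒∣F∣^k≤N {v = v} indep = ℕ.≤-trans
    (injective⇒length≥ lincomb-congˡ (Equivalence.to Independent⇔Injectiveⱽ indep) (λ w _ → ∈-allFin _))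
    (ℕ.≤-reflexive (length-tabulate (λ i → i)))

  ∣W∣≡∣F∣^dim : ∀ {W m} → IsSubspace F W → HasDim F W m → ∣ W ∣ ≡ ∣ F ∣ ^ m
  ∣W∣≡∣F∣^dim {W} W-subspace (v , v∈W , W⊆⟨v⟩ , indep) = ≡.trans (≡.sym (length-members W)) (ℕ.≤-antisym
    (covered⇒length≤ lincomb-congˡ (Unique-members W)
      (λ j∈ → W⊆⟨v⟩ _ (Equivalence.from e∈⇔∈ₛ (Equivalence.to ∈-members j∈))))
    (injective⇒length≥ lincomb-congˡ (Equivalence.to Independent⇔Injectiveⱽ indep)
      (λ w w∈F → Equivalence.from ∈-members (Equivalence.to ∈⇔idx∈
        (lincomb-closed (subspace⇒linearlyClosed W-subspace) w v w∈F v∈W)))))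

  IsSubspace? : ∀ W → Dec (IsSubspace F W)
  IsSubspace? W = 0# ∈? W ×-dec +-closed? ×-dec ·-closed?
    where
    +-closed? : Dec (∀ x y → x ∈ W → y ∈ W → (x + y) ∈ W)
    +-closed? = ∀? (λ x≈x′ Px y x′∈ y∈ → ∈-resp-≈ (+-congʳ x≈x′) (Px y (∈-resp-≈ (sym x≈x′) x′∈) y∈)) λ x →
                ∀? (λ y≈y′ Py x∈ y′∈ → ∈-resp-≈ (+-congˡ y≈y′) (Py x∈ (∈-resp-≈ (sym y≈y′) y′∈))) λ y →
                x ∈? W →-dec y ∈? W →-dec (x + y) ∈? W
    ·-closed? : Dec (∀ a x → a ∈ F → x ∈ W → (a * x) ∈ W)
    ·-closed? = ∀? (λ a≈a′ Pa x a′∈ x∈ → ∈-resp-≈ (*-congʳ a≈a′) (Pa x (∈-resp-≈ (sym a≈a′) a′∈) x∈)) λ a →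
                ∀? (λ x≈x′ Px a∈ x′∈ → ∈-resp-≈ (*-congˡ x≈x′) (Px a∈ (∈-resp-≈ (sym x≈x′) x′∈))) λ x →
                a ∈? F →-dec x ∈? W →-dec (a * x) ∈? W

  HasDim? : ∀ W m → Dec (HasDim F W m)
  HasDim? W m = ∃ⱽ? resp λ v → v ∈ⱽ? W ×-dec ∀? (λ x≈y Px y∈ → Image-resp-≈ x≈y (Px (∈-resp-≈ (sym x≈y) y∈)))
                                                  (λ w → w ∈? W →-dec Span? v w)
                                       ×-dec Independent? v
    where
    resp : (λ v → v ∈ⱽ W × (∀ w → w ∈ W → Span v w) × Independent v) Respects _≋_
    resp u≋v (u∈W , W⊆⟨u⟩ , indep) =
      ∈ⱽ-resp-≋ u≋v u∈W , (λ w w∈ → Span-cong u≋v (W⊆⟨u⟩ w w∈)) , Independent-cong u≋v indep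

  IsSplitting? : ∀ α n W → Dec (IsSplitting α n W)
  IsSplitting? α n W = ∀? Image-resp-≈ (Image? (αsum-cong α) W) ×-dec Injectiveⱽ? (αsum-cong α) W

  𝔖? : ∀ α m n W → Dec (𝔖 F α m n W)
  𝔖? α m n W = IsSubspace? W ×-dec HasDim? W m ×-dec IsSplitting? α n W

module Units {c ℓ} (K : CommutativeRing c ℓ) where
  open CommutativeRing K
  open import Relation.Binary.Reasoning.Setoid setoid

  unit-cancelˡ : ∀ {u u′ a b} → u′ * u ≈ 1# → u * a ≈ u * b → a ≈ b
  unit-cancelˡ {u} {u′} {a} {b} u′u≈1 ua≈ub = begin
    a            ≈⟨ *-identityˡ a ⟨
    1# * a       ≈⟨ *-congʳ u′u≈1 ⟨
    u′ * u * a   ≈⟨ *-assoc u′ u a ⟩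
    u′ * (u * a) ≈⟨ *-congˡ ua≈ub ⟩
    u′ * (u * b) ≈⟨ *-assoc u′ u b ⟨
    u′ * u * b   ≈⟨ *-congʳ u′u≈1 ⟩
    1# * b       ≈⟨ *-identityˡ b ⟩
    b            ∎

  unit-cancel-* : ∀ {u u′} → u′ * u ≈ 1# → ∀ x → u′ * (u * x) ≈ x
  unit-cancel-* {u} {u′} u′u≈1 x = trans (sym (*-assoc u′ u x)) (trans (*-congʳ u′u≈1) (*-identityˡ x))

module Field {c ℓ} (K : CommutativeRing c ℓ) {N : ℕ}
             (e : Fin N → CommutativeRing.Carrier K)
             (isF : FieldTheory.IsField K e) where
  open CommutativeRing K hiding (zero)
  open FieldTheory K e
  open Units K

  1≉0 : ¬ (1# ≈ 0#)
  1≉0 = proj₁ isF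

  inverse : ∀ {x} → ¬ (x ≈ 0#) → ∃[ y ] (y * x ≈ 1#)
  inverse {x} x≉0 with proj₂ isF x x≉0
  ... | y , xy≈1 = y , trans (*-comm y x) xy≈1

  *-cancelˡ : ∀ {x a b} → ¬ (x ≈ 0#) → x * a ≈ x * b → a ≈ b
  *-cancelˡ x≉0 = unit-cancelˡ (proj₂ (inverse x≉0))

module FiniteField {c ℓ} (K : CommutativeRing c ℓ) {N : ℕ}
                   (e : Fin N → CommutativeRing.Carrier K)
                   (isF : FieldTheory.IsField K e) (isE : FieldTheory.IsEnumeration K e) where
  open CommutativeRing K hiding (zero)
  open FieldTheory K e
  open Enumeration K e isE
  open Field K e isF

  -- x · _ is injective, so it permutes any finite set V it maps into itself; in particular it hits 1.
  finite-inverse : ∀ {p} {V : Carrier → Set p} → V Respects _≈_ → Decidable V → V 1# →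
    ∀ {x} → ¬ (x ≈ 0#) → (∀ {y} → V y → V (x * y)) → ∃[ y ] (V y × x * y ≈ 1#)
  finite-inverse {V = V} resp V? V1 {x} x≉0 xV⊆V =
    let j , j∈ , idx1≡xj = ∈-map⁻ x· 1∈xVs in e j , Vs∈ j∈ , sym (idx-injective idx1≡xj)
    where
    Vs : List (Fin N)
    Vs = filter (V? ∘ e) (allFin N)
    Vs∋ : ∀ {y} → V y → idx y ∈L Vs
    Vs∋ {y} Vy = ∈-filter⁺ (V? ∘ e) (∈-allFin (idx y)) (resp (sym (e∘idx y)) Vy)
    Vs∈ : ∀ {j} → j ∈L Vs → V (e j)
    Vs∈ j∈ = proj₂ (∈-filter⁻ (V? ∘ e) {xs = allFin N} j∈)
    x· : Fin N → Fin N
    x· j = idx (x * e j)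
    !xVs : Unique (mapL x· Vs)
    !xVs = Unique-map⁺ x· (λ _ _ eq → e-injective (*-cancelˡ x≉0 (idx-injective eq)))
                          (Unique.filter⁺ (V? ∘ e) (Unique.allFin⁺ N))
    xVs⊆Vs : ∀ {j} → j ∈L mapL x· Vs → j ∈L Vs
    xVs⊆Vs j∈ with ∈-map⁻ x· j∈
    ... | i , i∈ , ≡.refl = Vs∋ (xV⊆V (Vs∈ i∈))
    1∈xVs : idx 1# ∈L mapL x· Vs
    1∈xVs = Unique-⊆-length≥⇒⊇ Fin._≟_ !xVs xVs⊆Vs (ℕ.≤-reflexive (≡.sym (length-map x· Vs))) (Vs∋ V1)

module UnitScaling {c ℓ} (K : CommutativeRing c ℓ) {N : ℕ}
                   (e : Fin N → CommutativeRing.Carrier K)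
                   (isE : FieldTheory.IsEnumeration K e)
                   (u u′ : CommutativeRing.Carrier K)
                   (u′u≈1 : CommutativeRing._≈_ K (CommutativeRing._*_ K u′ u) (CommutativeRing.1# K)) where
  open CommutativeRing K hiding (zero)
  open FieldTheory K e
  open LinearAlgebra K e
  open Enumeration K e isE
  open Units K

  uu′≈1 : u * u′ ≈ 1#
  uu′≈1 = trans (*-comm u u′) u′u≈1

  scale : Subset N → Subset N
  scale W = tabulate (λ j → does ((u′ * e j) ∈? W))

  ∈scale⇔ : ∀ {W x} → x ∈ scale W ⇔ (u′ * x) ∈ W
  ∈scale⇔ {W} {x} = mk⇔
    (∈-resp-≈ (*-congˡ (e∘idx x)) ∘ Equivalence.to ∈scale∋ ∘ Equivalence.to ∈⇔idx∈)
    (Equivalence.from ∈⇔idx∈ ∘ Equivalence.from ∈scale∋ ∘ ∈-resp-≈ (*-congˡ (sym (e∘idx x))))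
    where
    ∈scale∋ : ∀ {j} → j ∈ₛ scale W ⇔ (u′ * e j) ∈ W
    ∈scale∋ = ∈-tabulate-does (λ j → (u′ * e j) ∈? W)

  *-∈scale : ∀ {W x} → x ∈ W → (u * x) ∈ scale W
  *-∈scale x∈W = Equivalence.from ∈scale⇔ (∈-resp-≈ (sym (unit-cancel-* u′u≈1 _)) x∈W)

  scale-injective : ∀ {W W′} → scale W ≡ scale W′ → W ≡ W′
  scale-injective {W} {W′} eq = ⊆-antisym (⊆ eq) (⊆ (≡.sym eq))
    where
    ⊆ : ∀ {S T} → scale S ≡ scale T → ∀ {i} → i ∈ₛ S → i ∈ₛ T
    ⊆ {S} {T} sS≡sT i∈S = Equivalence.to e∈⇔∈ₛ (∈-resp-≈ (unit-cancel-* u′u≈1 _)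
      (Equivalence.to ∈scale⇔ (≡.subst (_ ∈_) sS≡sT (*-∈scale (Equivalence.from e∈⇔∈ₛ i∈S)))))

  private
    u·ⱽ-∈scale : ∀ {k W} (w : Vec Carrier k) → w ∈ⱽ W → (u ·ⱽ w) ∈ⱽ scale W
    u·ⱽ-∈scale w w∈W i = ≡.subst (_∈ _) (≡.sym (lookup-map i (u *_) w)) (*-∈scale (w∈W i))

    u′·ⱽ-∈ : ∀ {k W} (w : Vec Carrier k) → w ∈ⱽ scale W → (u′ ·ⱽ w) ∈ⱽ W
    u′·ⱽ-∈ w w∈uW i = ≡.subst (_∈ _) (≡.sym (lookup-map i (u′ *_) w)) (Equivalence.to ∈scale⇔ (w∈uW i))

  scale-𝔖 : ∀ {F α m n W} → 𝔖 F α m n W → 𝔖 F α m n (scale W)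
  scale-𝔖 {F} {α} {m} {n} {W} ((0∈W , +∈W , ·∈W) , (v , v∈W , W⊆⟨v⟩ , indep) , (onto , inj)) =
    subspace , (u ·ⱽ v , u·ⱽ-∈scale v v∈W , spans , independent) , (onto′ , inj′)
    where
    to : ∀ {x} → x ∈ scale W → (u′ * x) ∈ W
    to = Equivalence.to ∈scale⇔
    from : ∀ {x} → (u′ * x) ∈ W → x ∈ scale W
    from = Equivalence.from ∈scale⇔
    subspace : IsSubspace F (scale W)
    subspace = from (∈-resp-≈ (sym (zeroʳ u′)) 0∈W)
      , (λ x y x∈ y∈ → from (∈-resp-≈ (sym (distribˡ u′ x y)) (+∈W _ _ (to x∈) (to y∈))))
      , (λ a x a∈F x∈ → from (∈-resp-≈ (*-left-comm a u′ x) (·∈W a _ a∈F (to x∈))))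
    spans : ∀ w → w ∈ scale W → ∃[ cs ] ((∀ i → lookup cs i ∈ F) × lincomb cs (u ·ⱽ v) ≈ w)
    spans w w∈ = let cs , cs∈F , csv≈u′w = W⊆⟨v⟩ (u′ * w) (to w∈) in
      cs , cs∈F , trans (lincomb-·ⱽʳ u cs v) (trans (*-congˡ csv≈u′w) (unit-cancel-* uu′≈1 w))
    independent : ∀ cs → (∀ i → lookup cs i ∈ F) → lincomb cs (u ·ⱽ v) ≈ 0# → ∀ i → lookup cs i ≈ 0#
    independent cs cs∈F cs·uv≈0 = indep cs cs∈F
      (unit-cancelˡ u′u≈1 (trans (sym (lincomb-·ⱽʳ u cs v)) (trans cs·uv≈0 (sym (zeroʳ u)))))
    onto′ : ∀ z → Image (αsum α {n}) (scale W) z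
    onto′ z = let w , w∈W , αw≈u′z = onto (u′ * z) in
      u ·ⱽ w , u·ⱽ-∈scale w w∈W , trans (αsum-·ⱽ α u w) (trans (*-congˡ αw≈u′z) (unit-cancel-* uu′≈1 z))
    inj′ : Injectiveⱽ (αsum α {n}) (scale W)
    inj′ w w′ w∈ w′∈ αw≈αw′ i = unit-cancelˡ uu′≈1 (begin
      u′ * lookup w i        ≡⟨ lookup-map i (u′ *_) w ⟨
      lookup (u′ ·ⱽ w) i     ≈⟨ inj (u′ ·ⱽ w) (u′ ·ⱽ w′) (u′·ⱽ-∈ w w∈) (u′·ⱽ-∈ w′ w′∈) αu′w≈αu′w′ i ⟩
      lookup (u′ ·ⱽ w′) i    ≡⟨ lookup-map i (u′ *_) w′ ⟩
      u′ * lookup w′ i       ∎)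
      where
      open import Relation.Binary.Reasoning.Setoid setoid
      αu′w≈αu′w′ : αsum α (u′ ·ⱽ w) ≈ αsum α (u′ ·ⱽ w′)
      αu′w≈αu′w′ = trans (αsum-·ⱽ α u′ w) (trans (*-congˡ αw≈αw′) (sym (αsum-·ⱽ α u′ w′)))

module PrimitiveElement {c ℓ} (K : CommutativeRing c ℓ) {N : ℕ}
                        (e : Fin N → CommutativeRing.Carrier K)
                        (isF : FieldTheory.IsField K e) (isE : FieldTheory.IsEnumeration K e)
                        (F : Subset N) (isSubfield : FieldTheory.IsSubfield K e F)
                        (α : CommutativeRing.Carrier K) where
  open CommutativeRing K hiding (zero)
  open FieldTheory K e
  open LinearAlgebra K e
  open Enumeration K e isE
  open Subspaces K e isE F isSubfield
  open Units K
  open Field K e isF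
  open FiniteField K e isF isE
  open import Algebra.Properties.Ring ring using (-‿distribˡ-*; -‿distribʳ-*)
  open import Algebra.Properties.Group +-group using (inverseˡ-unique)

  powers : (k : ℕ) → Vec Carrier k
  powers = descending (α ^′_)

  Span-powers-mono : ∀ {d k} → d ≤ k → ∀ {x} → Span (powers d) x → Span (powers k) x
  Span-powers-mono {d} d≤k = Span-mono λ i →
    let j , j<d , eq = lookup-descending (α ^′_) d i in ≡.subst (Span _) (≡.sym eq) (Span-descending (α ^′_) (ℕ.<-≤-trans j<d d≤k))

  Independent-powers-suc : ∀ {k} → Independent (powers k) → ¬ Span (powers k) (α ^′ k) →
    Independent (powers (suc k))
  Independent-powers-suc {k} indep α^k∉ (c ∷ cs) cs∈F csα≈0 with c ≈? 0#
  ... | yes c≈0 = λ { zero → c≈0 ; (suc i) → indep cs (cs∈F ∘ suc) L≈0 i }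
    where
    L≈0 : lincomb cs (powers k) ≈ 0#
    L≈0 = trans (sym (+-identityˡ _)) (trans (+-congʳ (sym (trans (*-congʳ c≈0) (zeroˡ _)))) csα≈0)
  ... | no c≉0 = contradiction α^k∈ α^k∉
    where
    c′ : Carrier
    c′ = proj₁ (inverse c≉0)
    c′c≈1 : c′ * c ≈ 1#
    c′c≈1 = proj₂ (inverse c≉0)
    L : Carrier
    L = lincomb cs (powers k)
    α^k≈ : α ^′ k ≈ (- c′) * L
    α^k≈ = begin
      α ^′ k            ≈⟨ unit-cancel-* c′c≈1 (α ^′ k) ⟨
      c′ * (c * α ^′ k) ≈⟨ *-congˡ (inverseˡ-unique _ L csα≈0) ⟩
      c′ * - L          ≈⟨ -‿distribʳ-* c′ L ⟨
      - (c′ * L)        ≈⟨ -‿distribˡ-* c′ L ⟩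
      - c′ * L          ∎
      where open import Relation.Binary.Reasoning.Setoid setoid
    α^k∈ : Span (powers k) (α ^′ k)
    α^k∈ = Image-resp-≈ (sym α^k≈) (LinearlyClosed.·-closed (Span-linearlyClosed (powers k))
      (-∈F (⁻¹∈F (cs∈F zero) c≉0 (trans (*-comm c c′) c′c≈1))) (cs , cs∈F ∘ suc , refl))

  dependency⊎independence : ∀ k → (∃[ d ] (d < k × Span (powers d) (α ^′ d))) ⊎ Independent (powers k)
  dependency⊎independence zero    = inj₂ λ _ _ _ ()
  dependency⊎independence (suc k) with dependency⊎independence k
  ... | inj₁ (d , d<k , α^d∈) = inj₁ (d , ℕ.m<n⇒m<1+n d<k , α^d∈)
  ... | inj₂ indep with Span? (powers k) (α ^′ k)
  ...   | yes α^k∈ = inj₁ (k , ℕ.≤-refl , α^k∈)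
  ...   | no  α^k∉ = inj₂ (Independent-powers-suc indep α^k∉)

  dependency⇒0< : ∀ {d} → Span (powers d) (α ^′ d) → 0 < d
  dependency⇒0< {zero}  ([] , _ , 0≈1) = contradiction (sym 0≈1) 1≉0
  dependency⇒0< {suc _} _              = s≤s z≤n

  -- Once α^d ∈ ⟨1, α, …, α^(d-1)⟩, that span is a subring, hence (being finite) a subfield.
  module SpanOfPowers (d : ℕ) (α^d∈ : Span (powers d) (α ^′ d)) where

    V : Carrier → Set (c ⊔ ℓ)
    V = Span (powers d)

    private
      open LinearlyClosed (Span-linearlyClosed (powers d))

      multiples-closed : ∀ {x} → (∀ {j} → j < d → V (x * α ^′ j)) → ∀ {y} → V y → V (x * y)
      multiples-closed {x} x·α^j∈ (cs , cs∈F , csα≈y) = Image-resp-≈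
        (trans (lincomb-·ⱽʳ x cs (powers d)) (*-congˡ csα≈y))
        (lincomb-closed (Span-linearlyClosed (powers d)) cs (x ·ⱽ powers d) cs∈F λ i →
          let j , j<d , eq = lookup-descending (α ^′_) d i in
          ≡.subst V (≡.sym (≡.trans (lookup-map i (x *_) (powers d)) (≡.cong (x *_) eq))) (x·α^j∈ j<d))

    α·-closed : ∀ {y} → V y → V (α * y)
    α·-closed = multiples-closed λ {j} j<d → case (suc j ℕ.≟ d) j<d
      where
      case : ∀ {j} → Dec (suc j ≡ d) → j < d → V (α * α ^′ j)
      case (yes ≡.refl) _   = α^d∈
      case (no  1+j≢d)  j<d = Span-descending (α ^′_) (ℕ.≤∧≢⇒< j<d 1+j≢d)

    ·α^-closed : ∀ {x} → V x → ∀ j → V (x * α ^′ j)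
    ·α^-closed x∈ zero    = Image-resp-≈ (sym (*-identityʳ _)) x∈
    ·α^-closed x∈ (suc j) = Image-resp-≈ (*-left-comm α _ _) (α·-closed (·α^-closed x∈ j))

    *-closed : ∀ {x y} → V x → V y → V (x * y)
    *-closed x∈ = multiples-closed (λ {j} _ → ·α^-closed x∈ j)

    1∈V : V 1#
    1∈V = Span-descending (α ^′_) (dependency⇒0< α^d∈)

    ⁻¹-closed : ∀ {x y} → V x → ¬ (x ≈ 0#) → x * y ≈ 1# → V y
    ⁻¹-closed {x} x∈ x≉0 xy≈1 =
      let y′ , y′∈ , xy′≈1 = finite-inverse Image-resp-≈ (Span? (powers d)) 1∈V x≉0 (*-closed x∈) in
      Image-resp-≈ (*-cancelˡ x≉0 (trans xy′≈1 (sym xy≈1))) y′∈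

    V-subfield : IsSubfieldP V
    V-subfield = 0-closed , 1∈V , (λ _ _ → +-closed)
      , (λ x x∈ → Image-resp-≈ (-1*x≈-x x) (·-closed (-∈F 1∈F) x∈))
      , (λ _ _ → *-closed) , (λ _ _ → ⁻¹-closed) , (λ _ _ → Image-resp-≈)
      where open import Algebra.Properties.Ring ring using (-1*x≈-x)

    V-everything : GeneratesOver F α → ∀ x → V x
    V-everything generates = generates V V-subfield
      (λ x x∈F → Image-resp-≈ (*-identityʳ x) (·-closed x∈F 1∈V))
      (Image-resp-≈ (*-identityʳ α) (α·-closed 1∈V))

  powers-span : GeneratesOver F α → ∀ k → N < ∣ F ∣ ^ suc k → ∀ x → Span (powers k) x
  powers-span generates k N<∣F∣^1+k x with dependency⊎independence (suc k)
  ... | inj₁ (d , s≤s d≤k , α^d∈) = Span-powers-mono d≤k (SpanOfPowers.V-everything d α^d∈ generates x)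
  ... | inj₂ indep = contradiction (Independent⇒∣F∣^k≤N indep) (ℕ.<⇒≱ N<∣F∣^1+k)

module StandardSplitting {c ℓ} (K : CommutativeRing c ℓ) {N : ℕ}
                         (e : Fin N → CommutativeRing.Carrier K)
                         (isF : FieldTheory.IsField K e) (isE : FieldTheory.IsEnumeration K e)
                         (F : Subset N) (isSubfield : FieldTheory.IsSubfield K e F)
                         (1<∣F∣ : 1 < ∣ F ∣)
                         (α : CommutativeRing.Carrier K) (generates : FieldTheory.GeneratesOver K e F α)
                         (m n : ℕ) (0<m : 0 < m) .{{_ : NonZero n}} (N≡∣F∣^mn : N ≡ ∣ F ∣ ^ (m ℕ.* n)) where
  open CommutativeRing K hiding (zero)
  open FieldTheory K e
  open LinearAlgebra K e
  open Enumeration K e isE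
  open Subspaces K e isE F isSubfield
  open PrimitiveElement K e isF isE F isSubfield α using (powers; powers-span)

  basis₀ : Vec Carrier m
  basis₀ = descending (λ i → α ^′ (i ℕ.* n)) m

  W₀ : Subset N
  W₀ = spanSet basis₀

  private
    W₀-closed : LinearlyClosed (_∈ W₀)
    W₀-closed = subspace⇒linearlyClosed (spanSet-subspace basis₀)

    α^in∈W₀ : ∀ {i} → i < m → (α ^′ (i ℕ.* n)) ∈ W₀
    α^in∈W₀ i<m = Equivalence.from ∈spanSet⇔Span (Span-descending _ i<m)

  αsum[W₀]-closed : LinearlyClosed (Image (αsum α {n}) W₀)
  αsum[W₀]-closed = record
    { 0-closed = 0ⱽ , 0ⱽ-closed (_∈ W₀) 0-closed , αsum-0ⱽ α {n}
    ; +-closed = λ (w , w∈ , αw≈x) (w′ , w′∈ , αw′≈y) →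
        w +ⱽ w′ , +ⱽ-closed (_∈ W₀) +-closed w w′ w∈ w′∈ , trans (αsum-+ⱽ α w w′) (+-cong αw≈x αw′≈y)
    ; ·-closed = λ a∈F (w , w∈ , αw≈x) →
        _ ·ⱽ w , ·ⱽ-closed (_∈ W₀) (·-closed a∈F) w w∈ , trans (αsum-·ⱽ α _ w) (*-congˡ αw≈x)
    }
    where open LinearlyClosed W₀-closed

  -- α^k = α^(k mod n) · α^((k div n) n), and the second factor lies in W₀
  α^-∈αsum[W₀] : ∀ {k} → k < m ℕ.* n → Image (αsum α {n}) W₀ (α ^′ k)
  α^-∈αsum[W₀] {k} k<mn = unit j (α ^′ (k / n ℕ.* n))
    , unit-closed (_∈ W₀) (LinearlyClosed.0-closed W₀-closed) j (α^in∈W₀ (m<n*o⇒m/o<n k<mn))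
    , (begin
      αsum α (unit j (α ^′ (k / n ℕ.* n)))   ≈⟨ αsum-unit α j _ ⟩
      α ^′ toℕ j * α ^′ (k / n ℕ.* n)        ≡⟨ ≡.cong (λ r → α ^′ r * α ^′ (k / n ℕ.* n)) (toℕ-fromℕ< (m%n<n k n)) ⟩
      α ^′ (k % n) * α ^′ (k / n ℕ.* n)      ≈⟨ ^′-+ α (k % n) _ ⟨
      α ^′ (k % n ℕ.+ k / n ℕ.* n)           ≡⟨ ≡.cong (α ^′_) (m≡m%n+[m/n]*n k n) ⟨
      α ^′ k                                 ∎)
    where
    open import Relation.Binary.Reasoning.Setoid setoid
    j : Fin n
    j = fromℕ< (m%n<n k n)

  W₀-onto : ∀ z → Image (αsum α {n}) W₀ z
  W₀-onto z =
    let cs , cs∈F , csα≈z = powers-span generates (m ℕ.* n) N<∣F∣^1+mn z in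
    Image-resp-≈ csα≈z (lincomb-closed αsum[W₀]-closed cs (powers (m ℕ.* n)) cs∈F λ i →
      let j , j<mn , eq = lookup-descending (α ^′_) (m ℕ.* n) i in
      ≡.subst (Image (αsum α) W₀) (≡.sym eq) (α^-∈αsum[W₀] j<mn))
    where
    N<∣F∣^1+mn : N < ∣ F ∣ ^ suc (m ℕ.* n)
    N<∣F∣^1+mn = ≡.subst (_< ∣ F ∣ ^ suc (m ℕ.* n)) (≡.sym N≡∣F∣^mn) (ℕ.^-monoʳ-< ∣ F ∣ 1<∣F∣ (ℕ.n<1+n (m ℕ.* n)))

  private
    W₀⊆⟨basis₀⟩ : ∀ {j} → j ∈L members W₀ → Span basis₀ (e j)
    W₀⊆⟨basis₀⟩ = Equivalence.to ∈spanSet⇔Span ∘ Equivalence.from e∈⇔∈ₛ ∘ Equivalence.to ∈-members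

    N≡length-allFin : N ≡ length (allFin N)
    N≡length-allFin = ≡.sym (length-tabulate (λ i → i))

  ∣W₀∣≡∣F∣^m : ∣ W₀ ∣ ≡ ∣ F ∣ ^ m
  ∣W₀∣≡∣F∣^m = ℕ.≤-antisym ∣W₀∣≤∣F∣^m (ℕ.≮⇒≥ λ ∣W₀∣<∣F∣^m → ℕ.<⇒≱ (ℕ.^-monoˡ-< n ∣W₀∣<∣F∣^m) (begin
    (∣ F ∣ ^ m) ^ n   ≡⟨ ℕ.^-*-assoc ∣ F ∣ m n ⟩
    ∣ F ∣ ^ (m ℕ.* n) ≡⟨ N≡∣F∣^mn ⟨
    N                 ≤⟨ N≤∣W₀∣^n ⟩
    ∣ W₀ ∣ ^ n        ∎))
    where
    open ℕ.≤-Reasoning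
    ∣W₀∣≤∣F∣^m : ∣ W₀ ∣ ≤ ∣ F ∣ ^ m
    ∣W₀∣≤∣F∣^m = ℕ.≤-trans (ℕ.≤-reflexive (≡.sym (length-members W₀)))
      (covered⇒length≤ lincomb-congˡ (Unique-members W₀) W₀⊆⟨basis₀⟩)
    N≤∣W₀∣^n : N ≤ ∣ W₀ ∣ ^ n
    N≤∣W₀∣^n = ℕ.≤-trans (ℕ.≤-reflexive N≡length-allFin)
      (covered⇒length≤ (αsum-cong α) (Unique.allFin⁺ N) (λ _ → W₀-onto _))

  -- by counting, the surjections F^m → W₀ and W₀^n → K are bijections
  basis₀-independent : Independent basis₀
  basis₀-independent = Equivalence.from Independent⇔Injectiveⱽ
    (onto⇒injective lincomb-congˡ (Unique-members W₀)
      (ℕ.≤-reflexive (≡.trans (≡.sym ∣W₀∣≡∣F∣^m) (≡.sym (length-members W₀)))) W₀⊆⟨basis₀⟩)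

  W₀-injective : Injectiveⱽ (αsum α {n}) W₀
  W₀-injective = onto⇒injective (αsum-cong α) (Unique.allFin⁺ N)
    (ℕ.≤-reflexive (≡.trans (≡.cong (_^ n) ∣W₀∣≡∣F∣^m)
      (≡.trans (ℕ.^-*-assoc ∣ F ∣ m n) (≡.trans (≡.sym N≡∣F∣^mn) N≡length-allFin))))
    (λ _ → W₀-onto _)

  W₀∈𝔖at1 : 𝔖at F α m n 1# W₀
  W₀∈𝔖at1 =
      ( spanSet-subspace basis₀
      , (basis₀ , (Equivalence.from ∈spanSet⇔Span ∘ Span-lookup basis₀)
                , (λ _ → Equivalence.to ∈spanSet⇔Span) , basis₀-independent)
      , W₀-onto , W₀-injective )
    , α^in∈W₀ 0<m

module Incidences {c ℓ} (K : CommutativeRing c ℓ) {N : ℕ}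
                  (e : Fin N → CommutativeRing.Carrier K)
                  (isF : FieldTheory.IsField K e) (isE : FieldTheory.IsEnumeration K e)
                  (F : Subset N) (isSubfield : FieldTheory.IsSubfield K e F)
                  (α : CommutativeRing.Carrier K) (m n : ℕ) where
  open CommutativeRing K using (Carrier; _≈_; _*_; 0#; 1#; trans; *-comm; *-identityʳ)
  open FieldTheory K e
  open Enumeration K e isE
  open Subspaces K e isE F isSubfield
  open Field K e isF
  open import Data.Nat using (_+_)

  𝔖s : List (Subset N)
  𝔖s = filter (𝔖? α m n) (allSubsets N)

  ∈𝔖s⇔𝔖 : ∀ {W} → W ∈L 𝔖s ⇔ 𝔖 F α m n W
  ∈𝔖s⇔𝔖 {W} = mk⇔ (proj₂ ∘ ∈-filter⁻ (𝔖? α m n) {xs = allSubsets N}) (∈-filter⁺ (𝔖? α m n) (∈-allSubsets W))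

  Unique-𝔖s : Unique 𝔖s
  Unique-𝔖s = Unique.filter⁺ (𝔖? α m n) (Unique-allSubsets N)

  count-𝔖 : HasCount (𝔖 F α m n) (length 𝔖s)
  count-𝔖 = 𝔖s , Unique-𝔖s , ≡.refl , λ _ → ∈𝔖s⇔𝔖

  through : Fin N → List (Subset N)
  through i = filter (i ∈ₛ?_) 𝔖s

  ∈through⇔𝔖at : ∀ {x W} → W ∈L through (idx x) ⇔ 𝔖at F α m n x W
  ∈through⇔𝔖at = mk⇔
    (λ W∈ → let W∈𝔖s , idx∈W = ∈-filter⁻ (_ ∈ₛ?_) {xs = 𝔖s} W∈ in
            Equivalence.to ∈𝔖s⇔𝔖 W∈𝔖s , Equivalence.from ∈⇔idx∈ idx∈W)
    (λ (W∈𝔖 , x∈W) → ∈-filter⁺ (_ ∈ₛ?_) (Equivalence.from ∈𝔖s⇔𝔖 W∈𝔖) (Equivalence.to ∈⇔idx∈ x∈W))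

  count-𝔖at : ∀ x → HasCount (𝔖at F α m n x) (length (through (idx x)))
  count-𝔖at x = through (idx x) , Unique.filter⁺ (idx x ∈ₛ?_) Unique-𝔖s , ≡.refl , λ _ → ∈through⇔𝔖at

  through-0 : through (idx 0#) ≡ 𝔖s
  through-0 = filter-all (idx 0# ∈ₛ?_) (All.tabulate λ W∈ →
    Equivalence.to ∈⇔idx∈ (proj₁ (proj₁ (Equivalence.to ∈𝔖s⇔𝔖 W∈))))

  -- W ↦ u W maps the subspaces through x injectively to those through u x.
  through-≤ : ∀ {u u′} → u′ * u ≈ 1# → ∀ x → length (through (idx x)) ≤ length (through (idx (u * x)))
  through-≤ {u} {u′} u′u≈1 x = ℕ.≤-trans (ℕ.≤-reflexive (≡.sym (length-map scale (through (idx x)))))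
    (Unique-⊆⇒length≤ (≡-dec Bool._≟_)
      (Unique-map⁺ scale (λ _ _ → scale-injective) (Unique.filter⁺ (idx x ∈ₛ?_) Unique-𝔖s)) uW⊆)
    where
    open UnitScaling K e isE u u′ u′u≈1
    uW⊆ : ∀ {V} → V ∈L mapL scale (through (idx x)) → V ∈L through (idx (u * x))
    uW⊆ V∈ with ∈-map⁻ scale V∈
    ... | W , W∈ , ≡.refl = let W∈𝔖 , x∈W = Equivalence.to ∈through⇔𝔖at W∈ in
      Equivalence.from ∈through⇔𝔖at (scale-𝔖 W∈𝔖 , *-∈scale x∈W)

  t : ℕ
  t = length (through (idx 1#))

  through-invariant : ∀ {x} → ¬ (x ≈ 0#) → length (through (idx x)) ≡ t
  through-invariant {x} x≉0 = ℕ.≤-antisym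
    (≡.subst (λ i → length (through (idx x)) ≤ length (through i)) (idx-cong x′x≈1)
      (through-≤ (trans (*-comm x x′) x′x≈1) x))
    (≡.subst (λ i → length (through (idx 1#)) ≤ length (through i)) (idx-cong (*-identityʳ x))
      (through-≤ x′x≈1 1#))
    where
    x′ : Carrier
    x′ = proj₁ (inverse x≉0)
    x′x≈1 : x′ * x ≈ 1#
    x′x≈1 = proj₂ (inverse x≉0)

  -- Each of the s subspaces has |F|^m elements, 0 lies in all s of them and each other element in t.
  incidence-count : length 𝔖s ℕ.* ∣ F ∣ ^ m ≡ length 𝔖s + (N ∸ 1) ℕ.* t
  incidence-count = begin
    length 𝔖s ℕ.* ∣ F ∣ ^ m                       ≡⟨ incidences _ 𝔖s (All.tabulate dim-count) ⟩
    ∑[ i < N ] length (through i)                  ≡⟨ ∑-allBut t _ (idx 0#) through-nonzero ⟩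
    length (through (idx 0#)) + (N ∸ 1) ℕ.* t      ≡⟨ ≡.cong (λ Ws → length Ws + (N ∸ 1) ℕ.* t) through-0 ⟩
    length 𝔖s + (N ∸ 1) ℕ.* t                      ∎
    where
    open ≡.≡-Reasoning
    dim-count : ∀ {W} → W ∈L 𝔖s → ∣ W ∣ ≡ ∣ F ∣ ^ m
    dim-count W∈ = let W-subspace , W-dim , _ = Equivalence.to ∈𝔖s⇔𝔖 W∈ in ∣W∣≡∣F∣^dim W-subspace W-dim
    through-nonzero : ∀ i → i ≢ idx 0# → length (through i) ≡ t
    through-nonzero i i≢0 = ≡.trans (≡.cong (length ∘ through) (≡.sym (idx∘e i)))
      (through-invariant (λ eᵢ≈0 → i≢0 (≡.trans (≡.sym (idx∘e i)) (idx-cong eᵢ≈0))))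

primePower>1 : ∀ {q} → IsPrimePower q → 1 < q
primePower>1 (p , k , p-prime , 1≤k , ≡.refl) =
  ℕ.^-monoʳ-< p (ℕ.nonTrivial⇒n>1 p {{prime⇒nonTrivial p-prime}}) 1≤k

open import Data.Nat using (_*_)

proposition4p1 : ∀ {c ℓ} (q m n : ℕ) → IsPrimePower q → 1 ≤ m → 1 ≤ n
    → (K : CommutativeRing c ℓ) (e : Fin (q ^ (m * n)) → CommutativeRing.Carrier K)
    → FieldTheory.IsField K e → FieldTheory.IsEnumeration K e
    → (F : Subset (q ^ (m * n))) → FieldTheory.IsSubfield K e F → ∣ F ∣ ≡ q
    → (α : CommutativeRing.Carrier K) → FieldTheory.GeneratesOver K e F α
    → ∃[ s ] ∃[ t ]
        ( HasCount (FieldTheory.𝔖 K e F α m n) s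
        × (∀ x → ¬ (CommutativeRing._≈_ K x (CommutativeRing.0# K))
             → HasCount (FieldTheory.𝔖at K e F α m n x) t)
        × 1 ≤ t
        × s * (q ^ m ∸ 1) ≡ t * (q ^ (m * n) ∸ 1) )
proposition4p1 q m n q-primePower 1≤m 1≤n K e isF isE F isSubfield ∣F∣≡q α generates =
  length 𝔖s , t , count-𝔖 , (λ x x≉0 → ≡.subst (HasCount _) (through-invariant x≉0) (count-𝔖at x))
  , ∈-length (Equivalence.from ∈through⇔𝔖at W₀∈𝔖at1)
  , ≡.subst (λ r → length 𝔖s * (r ^ m ∸ 1) ≡ t * (q ^ (m * n) ∸ 1)) ∣F∣≡q
      (s*q≡s+k*t⇒s*[q∸1]≡t*k (length 𝔖s) (∣ F ∣ ^ m) (q ^ (m * n) ∸ 1) t incidence-count)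
  where
  open Incidences K e isF isE F isSubfield α m n
  open StandardSplitting K e isF isE F isSubfield (≡.subst (1 <_) (≡.sym ∣F∣≡q) (primePower>1 q-primePower))
         α generates m n 1≤m {{ℕ.>-nonZero 1≤n}} (≡.cong (_^ (m * n)) (≡.sym ∣F∣≡q))
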